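{- Let $K$ be a field of characteristic $0$, $r\ge1$, $A(X)=\prod_{i=1}^r(X+\eta_i)$ and $B(X)=\prod_{j=1}^r(X+\zeta_j)$ with $\eta_i,\zeta_j\in K$ and $A(k)B(k)\ne0$ for all integers $k\ge0$. Let $(c_k)_{k\ge0}$ with $c_k\in K\setminus\{0\}$ and $c_{k+1}=c_kA(k)/B(k+1)$. Let $m,n\ge1$, $\alpha_1,\dots,\alpha_m\in K\setminus\{0\}$ pairwise distinct, and let $(\gamma_w)_{1\le w\le r(n+1)-1}$ be elements of $K$ with $\gamma_w=\zeta_{r+1-w}$ for $1\le w\le r$. Define $P_\ell$ and $\psi_{i,s}$ as below, and for $0\le \ell\le rm-1$ let $\vec q_\ell\in K^{rm}$ be the column vector $${}^t\big(\psi_{1,r-1}(t^nP_\ell(t)),\dots,\psi_{1,0}(t^nP_\ell(t)),\dots,\psi_{m,r-1}(t^nP_\ell(t)),\dots,\psi_{m,0}(t^nP_\ell(t))\big),$$ and $\Theta=\det(\vec q_0\ \cdots\ \vec q_{rm-1})$. For $0\le s\le r-1$ let $a_{0,s}$ be the constant coefficient in the (unique) expansion $$\prod_{j=1}^nA(X-j)=\sum_{k=0}^{rn}a_{k,s}\prod_{w=1}^k(X+\gamma_{r-s-1+w}).$$ Put $H_\ell(t)=t^\ell\prod_{i=1}^m(t-\alpha_i)^{rn}$ and write $t^nH_\ell(t)=\sum_k h_{\ell,k}t^k$. Then $$\Theta=\frac{\prod_{i=1}^m\alpha_i^r\prod_{s=0}^{r-1}a_{0,s}^m}{(n-1)!^{r^2m}}\cdot\det\big(M_{(i,s),\ell}\big),\qquad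 M_{(i,s),\ell}=\sum_k\frac{h_{\ell,k}\,\alpha_i^k}{(k+\zeta_1)(k+\zeta_2)\cdots(k+\zeta_{s+1})},$$ where the rows of the $rm\times rm$ matrix $M$ are indexed by pairs $(i,s)$, $1\le i\le m$, $0\le s\le r-1$, ordered lexicographically (first by $i$, then by increasing $s$), and the columns by $\ell=0,\dots,rm-1$.
   Context: $\theta_t=t\frac{d}{dt}$; for $H\in K[X]$, $a\in K$, $H(\theta_t+a)$ is the operator $t^p\mapsto H(p+a)t^p$ on $K[t]$. $\mathcal{T}_{\mathbf c}:K[t]\to K[t]$, $t^k\mapsto t^k/c_k$. $\psi_{i,s}:K[t]\to K$ is the $K$-linear map $t^k\mapsto(k+\gamma_1)\cdots(k+\gamma_s)c_k\alpha_i^{k+1}$ (empty product $=1$ for $s=0$). $P_\ell(t)=\frac{1}{(n-1)!^r}\mathcal{T}_{\mathbf c}\circ B(\theta_t+1)\circ\cdots\circ B(\theta_t+n-1)\big(t^\ell\prod_{i=1}^m(t-\alpha_i)^{rn}\big)$. Equivalently, $M_{(i,s),\ell}$ is the value at $t=\alpha_i$ of $(\theta_t+\gamma_{r-s})^{ -1}\circ\cdots\circ(\theta_t+\gamma_r)^{ -1}(t^nH_\ell(t))$. -}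

module Defs where

open import Level using (Level; _⊔_)
open import Algebra.Bundles using (CommutativeRing)
open import Data.Nat as ℕ using (ℕ; zero; suc; _∸_)
open import Data.Nat.Properties using ()
open import Data.Nat using (_!)
open import Data.Fin as Fin using (Fin; toℕ; remQuot; punchIn; inject≤)
open import Data.Fin.Properties using (toℕ<n)
open import Data.List as List using (List; []; _∷_; _++_; replicate; length)
open import Data.Product using (_×_; _,_; proj₁; proj₂)
open import Relation.Nullary using (¬_)

record Field (a ℓ : Level) : Set (Level.suc (a ⊔ ℓ)) where
  infix 8 _⁻¹
  field
    commutativeRing : CommutativeRing a ℓ
  open CommutativeRing commutativeRing public
  field
    _⁻¹ : Carrier → Carrier
    ⁻¹-inverseʳ : ∀ x → ¬ (x ≈ 0#) → (x * (x ⁻¹)) ≈ 1#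
    0≉1 : ¬ (0# ≈ 1#)

module FieldOps {a ℓ} (F : Field a ℓ) where
  open Field F public

  ι : ℕ → Carrier
  ι zero = 0#
  ι (suc n) = 1# + ι n

  CharZero : Set ℓ
  CharZero = ∀ n → ¬ (ι (suc n) ≈ 0#)

  pow : Carrier → ℕ → Carrier
  pow x zero = 1#
  pow x (suc n) = x * pow x n

  sumℕ : ℕ → (ℕ → Carrier) → Carrier
  sumℕ zero f = 0#
  sumℕ (suc n) f = sumℕ n f + f n

  prodℕ : ℕ → (ℕ → Carrier) → Carrier
  prodℕ zero f = 1#
  prodℕ (suc n) f = prodℕ n f * f n

  sumFin : ∀ {n} → (Fin n → Carrier) → Carrier
  sumFin {zero} f = 0#
  sumFin {suc n} f = f Fin.zero + sumFin (λ i → f (Fin.suc i))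

  prodFin : ∀ {n} → (Fin n → Carrier) → Carrier
  prodFin {zero} f = 1#
  prodFin {suc n} f = f Fin.zero * prodFin (λ i → f (Fin.suc i))

  -- Polynomials in K[t] as coefficient lists (constant term first).
  Poly : Set a
  Poly = List Carrier

  coeff : Poly → ℕ → Carrier
  coeff [] k = 0#
  coeff (x ∷ p) zero = x
  coeff (x ∷ p) (suc k) = coeff p k

  _≈P_ : Poly → Poly → Set ℓ
  p ≈P q = ∀ k → coeff p k ≈ coeff q k

  _+P_ : Poly → Poly → Poly
  [] +P q = q
  (x ∷ p) +P [] = x ∷ p
  (x ∷ p) +P (y ∷ q) = (x + y) ∷ (p +P q)

  scaleP : Carrier → Poly → Poly
  scaleP c p = List.map (c *_) p

  _*P_ : Poly → Poly → Poly
  [] *P q = []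
  (x ∷ p) *P q = scaleP x q +P (0# ∷ (p *P q))

  oneP : Poly
  oneP = 1# ∷ []

  linP : Carrier → Poly
  linP b = b ∷ 1# ∷ []

  powP : Poly → ℕ → Poly
  powP p zero = oneP
  powP p (suc n) = p *P powP p n

  prodFinP : ∀ {n} → (Fin n → Poly) → Poly
  prodFinP {zero} f = oneP
  prodFinP {suc n} f = f Fin.zero *P prodFinP (λ i → f (Fin.suc i))

  prodℕP : ℕ → (ℕ → Poly) → Poly
  prodℕP zero f = oneP
  prodℕP (suc n) f = prodℕP n f *P f n

  sumFinP : ∀ {n} → (Fin n → Poly) → Poly
  sumFinP {zero} f = []
  sumFinP {suc n} f = f Fin.zero +P sumFinP (λ i → f (Fin.suc i))

  shiftP : ℕ → Poly → Poly
  shiftP n p = replicate n 0# ++ p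

  diagOpFrom : ℕ → (ℕ → Carrier) → Poly → Poly
  diagOpFrom k f [] = []
  diagOpFrom k f (x ∷ p) = (f k * x) ∷ diagOpFrom (suc k) f p

  diagOp : (ℕ → Carrier) → Poly → Poly
  diagOp = diagOpFrom 0

  functional : (ℕ → Carrier) → Poly → Carrier
  functional f p = sumℕ (length p) (λ k → coeff p k * f k)

  det : ∀ n → (Fin n → Fin n → Carrier) → Carrier
  det zero M = 1#
  det (suc n) M =
    sumFin (λ j → pow (- 1#) (toℕ j) * (M Fin.zero j * det n (λ x y → M (Fin.suc x) (punchIn j y))))

  -- Objects of the paper.  Indices of η, ζ, α are 0-based:
  -- η (i : Fin r) stands for η_{i+1}, etc.  γ : ℕ → K is 1-based (γ w = γ_w).

  -- A(x) = Π_i (x + η_i)  (evaluation at x ∈ K); same for B with ζ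
  evalProd : ∀ {r} → (Fin r → Carrier) → Carrier → Carrier
  evalProd η x = prodFin (λ i → x + η i)

  shiftedPoly : ∀ {r} → (Fin r → Carrier) → ℕ → Poly
  shiftedPoly η j = prodFinP (λ i → linP (η i - ι j))

  Hpoly : ∀ {m} → (r n : ℕ) → (Fin m → Carrier) → ℕ → Poly
  Hpoly r n α ℓ = shiftP ℓ (prodFinP (λ i → powP (linP (- α i)) (r ℕ.* n)))

  -- B(θ_t + b) : t^p ↦ B(p + b) t^p
  Bop : ∀ {r} → (Fin r → Carrier) → ℕ → Poly → Poly
  Bop ζ b = diagOp (λ p → evalProd ζ (ι (p ℕ.+ b)))

  Bchain : ∀ {r} → (Fin r → Carrier) → ℕ → ℕ → Poly → Poly
  Bchain ζ b zero p = p
  Bchain ζ b (suc k) p = Bop ζ b (Bchain ζ (suc b) k p)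

  Tc : (ℕ → Carrier) → Poly → Poly
  Tc c = diagOp (λ k → c k ⁻¹)

  -- P_ℓ(t) = (n-1)!^{-r} T_c ∘ B(θ+1) ∘ ⋯ ∘ B(θ+n-1) (H_ℓ(t))
  Ppoly : ∀ {r m} → (Fin r → Carrier) → (ℕ → Carrier) → (n : ℕ) → (Fin m → Carrier) → ℕ → Poly
  Ppoly {r} ζ c n α ℓ =
    scaleP (pow (ι ((n ∸ 1) !)) r ⁻¹) (Tc c (Bchain ζ 1 (n ∸ 1) (Hpoly r n α ℓ)))

  -- ψ_{i,s} : t^k ↦ (k+γ_1)⋯(k+γ_s) c_k α_i^{k+1}
  ψ : (ℕ → Carrier) → (ℕ → Carrier) → Carrier → ℕ → Poly → Carrier
  ψ γ c αi s = functional (λ k → prodℕ s (λ w → ι k + γ (suc w)) * c k * pow αi (suc k))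

  -- Θ = det(q_0 ⋯ q_{rm-1}); row (i , j) (lexicographic, i : Fin m, j : Fin r)
  -- carries ψ_{i+1, r-1-j}(t^n P_ℓ(t)).
  Θ : ∀ {m} (r : ℕ) → (Fin r → Carrier) → (ℕ → Carrier) → (ℕ → Carrier) →
      (n : ℕ) → (Fin m → Carrier) → Carrier
  Θ {m} r ζ c γ n α =
    det (m ℕ.* r) (λ row ℓ →
      ψ γ c (α (proj₁ (remQuot {m} r row))) (r ∸ suc (toℕ (proj₂ (remQuot {m} r row))))
        (shiftP n (Ppoly ζ c n α (toℕ ℓ))))

  Mentry : ∀ {r m} → (Fin r → Carrier) → (n : ℕ) → (Fin m → Carrier) → Fin m → Fin r → ℕ → Carrier
  Mentry {r} ζ n α i s ℓ =
    functional (λ k → pow (α i) k *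
                      prodFin {suc (toℕ s)} (λ j → ι k + ζ (inject≤ j (toℕ<n s))) ⁻¹)
               (shiftP n (Hpoly r n α ℓ))

  detM : ∀ {m} (r : ℕ) → (Fin r → Carrier) → (n : ℕ) → (Fin m → Carrier) → Carrier
  detM {m} r ζ n α =
    det (m ℕ.* r) (λ row ℓ → Mentry ζ n α (proj₁ (remQuot {m} r row)) (proj₂ (remQuot {m} r row)) (toℕ ℓ))

  IsExpansion : ∀ {r} → (Fin r → Carrier) → (ℕ → Carrier) → (n : ℕ) → Fin r →
                (Fin (suc (r ℕ.* n)) → Carrier) → Set ℓ
  IsExpansion {r} η γ n s a =
    prodℕP n (λ j → shiftedPoly η (suc j))
      ≈P sumFinP (λ k → scaleP (a k)
            (prodℕP (toℕ k) (λ w → linP (γ (r ∸ suc (toℕ s) ℕ.+ suc w)))))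

{-# OPTIONS --safe #-}
module Submission where

-- Row (i, s) of Θ applies ψ_{i,s} to t^n P_ℓ, i.e. it is Σ_k h_{ℓ,k} w(k) for an explicit weight w.
-- The recursion of c telescopes, c_{n+k} B(k+1)⋯B(k+n-1) / c_k = A(k)⋯A(k+n-1) / B(n+k), and after
-- cancelling (K+γ₁)⋯(K+γ_s), K = n+k, the weight is (n-1)!^{-r} α_i^{K+1} ∏_{j=1}^n A(K-j) over
-- (K+γ_{s+1})⋯(K+γ_r). Expanding ∏_j A(K-j) in the basis ∏_{w≤e}(K+γ_{s+w}) splits this quotient into
-- Σ_{e ≤ r-1-s} a_{e,r-1-s} / ((K+ζ₁)⋯(K+ζ_{r-s-e})) plus a polynomial in K of degree < rn, which is
-- annihilated because α_i is a root of order rn of H_ℓ. So each row of Θ is (n-1)!^{-r} α_i a_{0,r-1-s}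
-- times a row of M plus a combination of the rows of M above it in the same block, and the determinant
-- of such a triangular transform of M is the product of the diagonal coefficients times det M.

open import Defs
open import Algebra.Bundles using (CommutativeMonoid)
import Algebra.Properties.CommutativeSemigroup as CommutativeSemigroupProperties
import Algebra.Properties.Ring as RingProperties
import Algebra.Solver.CommutativeMonoid as CommutativeMonoidSolver
open import Data.Empty using (⊥-elim)
open import Data.Fin as Fin using (Fin; toℕ; punchIn; punchOut; combine; remQuot; inject≤; _↑ˡ_; _↑ʳ_)
import Data.Fin.Properties as Fin
open import Data.List using ([]; _∷_; length)
open import Data.Nat as ℕ using (ℕ; zero; suc; _∸_; _≤_; _<_; z≤n; s≤s; _!)
import Data.Nat.Properties as ℕ
open import Data.Product using (proj₁; proj₂)
open import Function using (_∘_)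
open import Level using (_⊔_)
open import Relation.Nullary using (¬_; Dec; yes; no)
open import Relation.Binary.PropositionalEquality as ≡ using (_≡_; _≢_)
import Relation.Binary.Reasoning.Setoid as SetoidReasoning

module FoldProperties {c ℓ} (M : CommutativeMonoid c ℓ) where
  open CommutativeMonoid M
  open SetoidReasoning setoid
  open CommutativeSemigroupProperties commutativeSemigroup using (interchange; x∙yz≈y∙xz)

  -- ⨁ n f folds f 0, …, f (n-1) with the last term outermost, ⨁ᶠ folds a Fin-indexed family with the
  -- first term outermost; only their unfolding equations are used, so sums and products share one theory.
  module Folds
    (⨁ : ℕ → (ℕ → Carrier) → Carrier)
    (⨁-zero : ∀ f → ⨁ zero f ≈ ε)
    (⨁-suc : ∀ n f → ⨁ (suc n) f ≈ ⨁ n f ∙ f n)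
    (⨁ᶠ : ∀ {n} → (Fin n → Carrier) → Carrier)
    (⨁ᶠ-zero : ∀ f → ⨁ᶠ {zero} f ≈ ε)
    (⨁ᶠ-suc : ∀ {n} f → ⨁ᶠ {suc n} f ≈ f Fin.zero ∙ ⨁ᶠ (f ∘ Fin.suc))
    where

    ⨁-cong : ∀ n {f g} → (∀ k → k < n → f k ≈ g k) → ⨁ n f ≈ ⨁ n g
    ⨁-cong zero f≈g = trans (⨁-zero _) (sym (⨁-zero _))
    ⨁-cong (suc n) {f} {g} f≈g = begin
      ⨁ (suc n) f   ≈⟨ ⨁-suc n f ⟩
      ⨁ n f ∙ f n   ≈⟨ ∙-cong (⨁-cong n (λ k k<n → f≈g k (ℕ.m<n⇒m<1+n k<n))) (f≈g n ℕ.≤-refl) ⟩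
      ⨁ n g ∙ g n   ≈⟨ ⨁-suc n g ⟨
      ⨁ (suc n) g   ∎

    ⨁-congᵖ : ∀ n {f g} → (∀ k → f k ≈ g k) → ⨁ n f ≈ ⨁ n g
    ⨁-congᵖ n f≈g = ⨁-cong n (λ k _ → f≈g k)

    ⨁-head : ∀ n f → ⨁ (suc n) f ≈ f 0 ∙ ⨁ n (f ∘ suc)
    ⨁-head zero f = begin
      ⨁ 1 f        ≈⟨ ⨁-suc 0 f ⟩
      ⨁ 0 f ∙ f 0  ≈⟨ ∙-congʳ (⨁-zero f) ⟩
      ε ∙ f 0      ≈⟨ comm ε (f 0) ⟩
      f 0 ∙ ε      ≈⟨ ∙-congˡ (⨁-zero _) ⟨
      f 0 ∙ ⨁ 0 (f ∘ suc) ∎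
    ⨁-head (suc n) f = begin
      ⨁ (2 ℕ.+ n) f                              ≈⟨ ⨁-suc (suc n) f ⟩
      ⨁ (suc n) f ∙ f (suc n)                    ≈⟨ ∙-congʳ (⨁-head n f) ⟩
      (f 0 ∙ ⨁ n (f ∘ suc)) ∙ f (suc n)          ≈⟨ assoc _ _ _ ⟩
      f 0 ∙ (⨁ n (f ∘ suc) ∙ f (suc n))          ≈⟨ ∙-congˡ (⨁-suc n (f ∘ suc)) ⟨
      f 0 ∙ ⨁ (suc n) (f ∘ suc)                  ∎

    ⨁-split : ∀ p q f → ⨁ (p ℕ.+ q) f ≈ ⨁ p f ∙ ⨁ q (λ k → f (p ℕ.+ k))
    ⨁-split p zero f = begin
      ⨁ (p ℕ.+ 0) f   ≡⟨ ≡.cong (λ z → ⨁ z f) (ℕ.+-identityʳ p) ⟩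
      ⨁ p f           ≈⟨ identityʳ _ ⟨
      ⨁ p f ∙ ε       ≈⟨ ∙-congˡ (⨁-zero _) ⟨
      ⨁ p f ∙ ⨁ 0 _   ∎
    ⨁-split p (suc q) f = begin
      ⨁ (p ℕ.+ suc q) f                                   ≡⟨ ≡.cong (λ z → ⨁ z f) (ℕ.+-suc p q) ⟩
      ⨁ (suc (p ℕ.+ q)) f                                 ≈⟨ ⨁-suc _ f ⟩
      ⨁ (p ℕ.+ q) f ∙ f (p ℕ.+ q)                         ≈⟨ ∙-congʳ (⨁-split p q f) ⟩
      (⨁ p f ∙ ⨁ q (λ k → f (p ℕ.+ k))) ∙ f (p ℕ.+ q)     ≈⟨ assoc _ _ _ ⟩
      ⨁ p f ∙ (⨁ q (λ k → f (p ℕ.+ k)) ∙ f (p ℕ.+ q))     ≈⟨ ∙-congˡ (⨁-suc q _) ⟨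
      ⨁ p f ∙ ⨁ (suc q) (λ k → f (p ℕ.+ k))               ∎

    ⨁-reverse : ∀ n f → ⨁ n f ≈ ⨁ n (λ k → f (n ∸ suc k))
    ⨁-reverse zero f = ⨁-cong 0 (λ _ ())
    ⨁-reverse (suc n) f = begin
      ⨁ (suc n) f                                   ≈⟨ ⨁-suc n f ⟩
      ⨁ n f ∙ f n                                   ≈⟨ comm _ _ ⟩
      f n ∙ ⨁ n f                                   ≈⟨ ∙-congˡ (⨁-reverse n f) ⟩
      f n ∙ ⨁ n (λ k → f (n ∸ suc k))               ≈⟨ ⨁-head n (λ k → f (suc n ∸ suc k)) ⟨
      ⨁ (suc n) (λ k → f (suc n ∸ suc k))           ∎

    ⨁-distrib : ∀ n f g → ⨁ n (λ k → f k ∙ g k) ≈ ⨁ n f ∙ ⨁ n g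
    ⨁-distrib zero f g = begin
      ⨁ 0 _          ≈⟨ ⨁-zero _ ⟩
      ε              ≈⟨ identityˡ ε ⟨
      ε ∙ ε          ≈⟨ ∙-cong (⨁-zero f) (⨁-zero g) ⟨
      ⨁ 0 f ∙ ⨁ 0 g  ∎
    ⨁-distrib (suc n) f g = begin
      ⨁ (suc n) (λ k → f k ∙ g k)          ≈⟨ ⨁-suc n _ ⟩
      ⨁ n (λ k → f k ∙ g k) ∙ (f n ∙ g n)  ≈⟨ ∙-congʳ (⨁-distrib n f g) ⟩
      (⨁ n f ∙ ⨁ n g) ∙ (f n ∙ g n)        ≈⟨ interchange _ _ _ _ ⟩
      (⨁ n f ∙ f n) ∙ (⨁ n g ∙ g n)        ≈⟨ ∙-cong (⨁-suc n f) (⨁-suc n g) ⟨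
      ⨁ (suc n) f ∙ ⨁ (suc n) g            ∎

    ⨁-identity : ∀ n f → (∀ k → k < n → f k ≈ ε) → ⨁ n f ≈ ε
    ⨁-identity zero f _ = ⨁-zero f
    ⨁-identity (suc n) f f≈ε = begin
      ⨁ (suc n) f  ≈⟨ ⨁-suc n f ⟩
      ⨁ n f ∙ f n  ≈⟨ ∙-cong (⨁-identity n f (λ k k<n → f≈ε k (ℕ.m<n⇒m<1+n k<n))) (f≈ε n ℕ.≤-refl) ⟩
      ε ∙ ε        ≈⟨ identityˡ ε ⟩
      ε            ∎

    ⨁ᶠ-cong : ∀ {n} {f g : Fin n → Carrier} → (∀ i → f i ≈ g i) → ⨁ᶠ f ≈ ⨁ᶠ g
    ⨁ᶠ-cong {zero} _ = trans (⨁ᶠ-zero _) (sym (⨁ᶠ-zero _))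
    ⨁ᶠ-cong {suc n} f≈g = trans (⨁ᶠ-suc _) (trans (∙-cong (f≈g Fin.zero) (⨁ᶠ-cong (f≈g ∘ Fin.suc))) (sym (⨁ᶠ-suc _)))

    ⨁ᶠ-toℕ : ∀ {n} (f : Fin n → Carrier) g → (∀ i → f i ≈ g (toℕ i)) → ⨁ᶠ f ≈ ⨁ n g
    ⨁ᶠ-toℕ {zero} f g _ = trans (⨁ᶠ-zero f) (sym (⨁-zero g))
    ⨁ᶠ-toℕ {suc n} f g f≈g = begin
      ⨁ᶠ f                     ≈⟨ ⨁ᶠ-suc f ⟩
      f Fin.zero ∙ ⨁ᶠ (f ∘ Fin.suc) ≈⟨ ∙-cong (f≈g Fin.zero) (⨁ᶠ-toℕ (f ∘ Fin.suc) (g ∘ suc) (f≈g ∘ Fin.suc)) ⟩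
      g 0 ∙ ⨁ n (g ∘ suc)      ≈⟨ ⨁-head n g ⟨
      ⨁ (suc n) g              ∎

    ⨁ᶠ-distrib : ∀ {n} (f g : Fin n → Carrier) → ⨁ᶠ (λ i → f i ∙ g i) ≈ ⨁ᶠ f ∙ ⨁ᶠ g
    ⨁ᶠ-distrib {zero} f g = begin
      ⨁ᶠ _           ≈⟨ ⨁ᶠ-zero _ ⟩
      ε              ≈⟨ identityˡ ε ⟨
      ε ∙ ε          ≈⟨ ∙-cong (⨁ᶠ-zero f) (⨁ᶠ-zero g) ⟨
      ⨁ᶠ f ∙ ⨁ᶠ g    ∎
    ⨁ᶠ-distrib {suc n} f g = begin
      ⨁ᶠ (λ i → f i ∙ g i)                                    ≈⟨ ⨁ᶠ-suc _ ⟩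
      (f₀ ∙ g₀) ∙ ⨁ᶠ (λ i → f (Fin.suc i) ∙ g (Fin.suc i))   ≈⟨ ∙-congˡ (⨁ᶠ-distrib (f ∘ Fin.suc) (g ∘ Fin.suc)) ⟩
      (f₀ ∙ g₀) ∙ (⨁ᶠ (f ∘ Fin.suc) ∙ ⨁ᶠ (g ∘ Fin.suc))       ≈⟨ interchange _ _ _ _ ⟩
      (f₀ ∙ ⨁ᶠ (f ∘ Fin.suc)) ∙ (g₀ ∙ ⨁ᶠ (g ∘ Fin.suc))       ≈⟨ ∙-cong (⨁ᶠ-suc f) (⨁ᶠ-suc g) ⟨
      ⨁ᶠ f ∙ ⨁ᶠ g                                             ∎
      where
      f₀ g₀ : Carrier
      f₀ = f Fin.zero
      g₀ = g Fin.zero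

    ⨁ᶠ-identity : ∀ {n} (f : Fin n → Carrier) → (∀ i → f i ≈ ε) → ⨁ᶠ f ≈ ε
    ⨁ᶠ-identity {zero} f _ = ⨁ᶠ-zero f
    ⨁ᶠ-identity {suc n} f f≈ε =
      trans (⨁ᶠ-suc f) (trans (∙-cong (f≈ε Fin.zero) (⨁ᶠ-identity (f ∘ Fin.suc) (f≈ε ∘ Fin.suc))) (identityˡ ε))

    ⨁ᶠ-comm : ∀ {m n} (f : Fin m → Fin n → Carrier) → ⨁ᶠ (λ i → ⨁ᶠ (f i)) ≈ ⨁ᶠ (λ j → ⨁ᶠ (λ i → f i j))
    ⨁ᶠ-comm {zero} f = trans (⨁ᶠ-zero _) (sym (⨁ᶠ-identity _ (λ _ → ⨁ᶠ-zero _)))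
    ⨁ᶠ-comm {suc m} f = begin
      ⨁ᶠ (λ i → ⨁ᶠ (f i))                                           ≈⟨ ⨁ᶠ-suc _ ⟩
      ⨁ᶠ (f Fin.zero) ∙ ⨁ᶠ (λ i → ⨁ᶠ (f (Fin.suc i)))               ≈⟨ ∙-congˡ (⨁ᶠ-comm (f ∘ Fin.suc)) ⟩
      ⨁ᶠ (f Fin.zero) ∙ ⨁ᶠ (λ j → ⨁ᶠ (λ i → f (Fin.suc i) j))       ≈⟨ ⨁ᶠ-distrib _ _ ⟨
      ⨁ᶠ (λ j → f Fin.zero j ∙ ⨁ᶠ (λ i → f (Fin.suc i) j))          ≈⟨ ⨁ᶠ-cong (λ j → ⨁ᶠ-suc _) ⟨
      ⨁ᶠ (λ j → ⨁ᶠ (λ i → f i j))                                   ∎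

    ⨁ᶠ-punchIn : ∀ {n} (f : Fin (suc n) → Carrier) i → ⨁ᶠ f ≈ f i ∙ ⨁ᶠ (f ∘ punchIn i)
    ⨁ᶠ-punchIn f Fin.zero = ⨁ᶠ-suc f
    ⨁ᶠ-punchIn {suc n} f (Fin.suc i) = begin
      ⨁ᶠ f                                                          ≈⟨ ⨁ᶠ-suc f ⟩
      f Fin.zero ∙ ⨁ᶠ (f ∘ Fin.suc)                                 ≈⟨ ∙-congˡ (⨁ᶠ-punchIn (f ∘ Fin.suc) i) ⟩
      f Fin.zero ∙ (f (Fin.suc i) ∙ ⨁ᶠ (f ∘ Fin.suc ∘ punchIn i))   ≈⟨ x∙yz≈y∙xz _ _ _ ⟩
      f (Fin.suc i) ∙ (f Fin.zero ∙ ⨁ᶠ (f ∘ Fin.suc ∘ punchIn i))   ≈⟨ ∙-congˡ (⨁ᶠ-suc (f ∘ punchIn (Fin.suc i))) ⟨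
      f (Fin.suc i) ∙ ⨁ᶠ (f ∘ punchIn (Fin.suc i))                  ∎

    ⨁ᶠ-++ : ∀ p {q} (f : Fin (p ℕ.+ q) → Carrier) → ⨁ᶠ f ≈ ⨁ᶠ (λ i → f (i ↑ˡ q)) ∙ ⨁ᶠ (λ j → f (p ↑ʳ j))
    ⨁ᶠ-++ zero f = begin
      ⨁ᶠ f                   ≈⟨ identityˡ _ ⟨
      ε ∙ ⨁ᶠ f               ≈⟨ ∙-congʳ (⨁ᶠ-zero _) ⟨
      ⨁ᶠ {zero} _ ∙ ⨁ᶠ f     ∎
    ⨁ᶠ-++ (suc p) {q} f = begin
      ⨁ᶠ f                                                                              ≈⟨ ⨁ᶠ-suc f ⟩
      f Fin.zero ∙ ⨁ᶠ (f ∘ Fin.suc)                                                     ≈⟨ ∙-congˡ (⨁ᶠ-++ p (f ∘ Fin.suc)) ⟩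
      f Fin.zero ∙ (⨁ᶠ (λ i → f (Fin.suc (i ↑ˡ q))) ∙ ⨁ᶠ (λ j → f (Fin.suc (p ↑ʳ j))))  ≈⟨ assoc _ _ _ ⟨
      (f Fin.zero ∙ ⨁ᶠ (λ i → f (Fin.suc (i ↑ˡ q)))) ∙ ⨁ᶠ (λ j → f (suc p ↑ʳ j))        ≈⟨ ∙-congʳ (⨁ᶠ-suc _) ⟨
      ⨁ᶠ (λ i → f (i ↑ˡ q)) ∙ ⨁ᶠ (λ j → f (suc p ↑ʳ j))                                 ∎

    ⨁ᶠ-combine : ∀ m {n} (f : Fin (m ℕ.* n) → Carrier) → ⨁ᶠ f ≈ ⨁ᶠ {m} (λ i → ⨁ᶠ {n} (λ j → f (combine i j)))
    ⨁ᶠ-combine zero f = trans (⨁ᶠ-zero f) (sym (⨁ᶠ-zero _))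
    ⨁ᶠ-combine (suc m) {n} f = begin
      ⨁ᶠ f                                                              ≈⟨ ⨁ᶠ-++ n f ⟩
      ⨁ᶠ (λ j → f (j ↑ˡ m ℕ.* n)) ∙ ⨁ᶠ (λ k → f (n ↑ʳ k))               ≈⟨ ∙-congˡ (⨁ᶠ-combine m (λ k → f (n ↑ʳ k))) ⟩
      ⨁ᶠ (λ j → f (j ↑ˡ m ℕ.* n)) ∙ ⨁ᶠ (λ i → ⨁ᶠ (λ j → f (combine (Fin.suc i) j)))  ≈⟨ ⨁ᶠ-suc _ ⟨
      ⨁ᶠ (λ i → ⨁ᶠ (λ j → f (combine i j)))                             ∎

module FieldProperties {a ℓ} (F : Field a ℓ) where
  open FieldOps F public
  open RingProperties ring public
    using (-‿involutive; -0#≈0#; -‿distribˡ-*; -‿distribʳ-*)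
  open SetoidReasoning setoid public
  open CommutativeMonoidSolver *-commutativeMonoid public
    using () renaming (solve to *-solve; _⊕_ to _⊗_; _⊜_ to _⊜_)
  open CommutativeSemigroupProperties +-commutativeSemigroup public
    using () renaming (interchange to +-interchange)
  open CommutativeSemigroupProperties *-commutativeSemigroup public
    using () renaming (interchange to *-interchange)

  module ∑ = FoldProperties.Folds +-commutativeMonoid
    sumℕ (λ _ → refl) (λ _ _ → refl) sumFin (λ _ → refl) (λ _ → refl)
  module ∏ = FoldProperties.Folds *-commutativeMonoid
    prodℕ (λ _ → refl) (λ _ _ → refl) prodFin (λ _ → refl) (λ _ → refl)

  ∑-*ˡ : ∀ n c f → sumℕ n (λ k → c * f k) ≈ c * sumℕ n f
  ∑-*ˡ zero c f = sym (zeroʳ c)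
  ∑-*ˡ (suc n) c f = trans (+-congʳ (∑-*ˡ n c f)) (sym (distribˡ c _ _))

  ∑ᶠ-*ˡ : ∀ {n} c (f : Fin n → Carrier) → sumFin (λ i → c * f i) ≈ c * sumFin f
  ∑ᶠ-*ˡ {zero} c f = sym (zeroʳ c)
  ∑ᶠ-*ˡ {suc n} c f = trans (+-congˡ (∑ᶠ-*ˡ c (f ∘ Fin.suc))) (sym (distribˡ c _ _))

  ∑ᶠ-neg : ∀ {n} (f : Fin n → Carrier) → sumFin (λ i → - f i) ≈ - sumFin f
  ∑ᶠ-neg {zero} f = sym -0#≈0#
  ∑ᶠ-neg {suc n} f = trans (+-congˡ (∑ᶠ-neg (f ∘ Fin.suc))) (-‿+-comm _ _)
    where open RingProperties ring using (-‿+-comm)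

  infix 4 _≉0
  _≉0 : Carrier → Set ℓ
  x ≉0 = ¬ (x ≈ 0#)

  1≉0 : 1# ≉0
  1≉0 = 0≉1 ∘ sym

  ≉0-cong : ∀ {x y} → x ≈ y → x ≉0 → y ≉0
  ≉0-cong x≈y x≉0 y≈0 = x≉0 (trans x≈y y≈0)

  ⁻¹-inverseˡ : ∀ x → x ≉0 → x ⁻¹ * x ≈ 1#
  ⁻¹-inverseˡ x x≉0 = trans (*-comm _ x) (⁻¹-inverseʳ x x≉0)

  *-inverse-product : ∀ {x y} → x ≉0 → y ≉0 → (x * y) * (x ⁻¹ * y ⁻¹) ≈ 1#
  *-inverse-product {x} {y} x≉0 y≉0 = begin
    (x * y) * (x ⁻¹ * y ⁻¹)   ≈⟨ *-interchange x y (x ⁻¹) (y ⁻¹) ⟩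
    (x * x ⁻¹) * (y * y ⁻¹)   ≈⟨ *-cong (⁻¹-inverseʳ x x≉0) (⁻¹-inverseʳ y y≉0) ⟩
    1# * 1#                   ≈⟨ *-identityˡ 1# ⟩
    1#                        ∎

  *-≉0 : ∀ {x y} → x ≉0 → y ≉0 → x * y ≉0
  *-≉0 {x} {y} x≉0 y≉0 xy≈0 = 0≉1 (begin
    0#                        ≈⟨ zeroˡ _ ⟨
    0# * (x ⁻¹ * y ⁻¹)        ≈⟨ *-congʳ xy≈0 ⟨
    (x * y) * (x ⁻¹ * y ⁻¹)   ≈⟨ *-inverse-product x≉0 y≉0 ⟩
    1#                        ∎)

  ≉0-*ˡ : ∀ x y → x * y ≉0 → x ≉0
  ≉0-*ˡ x y xy≉0 x≈0 = xy≉0 (trans (*-congʳ x≈0) (zeroˡ y))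

  ≉0-*ʳ : ∀ x y → x * y ≉0 → y ≉0
  ≉0-*ʳ x y xy≉0 y≈0 = xy≉0 (trans (*-congˡ y≈0) (zeroʳ x))

  ⁻¹-unique : ∀ x y → x ≉0 → x * y ≈ 1# → y ≈ x ⁻¹
  ⁻¹-unique x y x≉0 xy≈1 = begin
    y                ≈⟨ *-identityˡ y ⟨
    1# * y           ≈⟨ *-congʳ (⁻¹-inverseˡ x x≉0) ⟨
    (x ⁻¹ * x) * y   ≈⟨ *-assoc _ x y ⟩
    x ⁻¹ * (x * y)   ≈⟨ *-congˡ xy≈1 ⟩
    x ⁻¹ * 1#        ≈⟨ *-identityʳ _ ⟩
    x ⁻¹             ∎

  ⁻¹-cong : ∀ {x y} → x ≉0 → x ≈ y → x ⁻¹ ≈ y ⁻¹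
  ⁻¹-cong {x} {y} x≉0 x≈y =
    ⁻¹-unique y (x ⁻¹) (≉0-cong x≈y x≉0) (trans (*-congʳ (sym x≈y)) (⁻¹-inverseʳ x x≉0))

  ⁻¹-distrib-* : ∀ x y → x ≉0 → y ≉0 → (x * y) ⁻¹ ≈ x ⁻¹ * y ⁻¹
  ⁻¹-distrib-* x y x≉0 y≉0 = sym (⁻¹-unique (x * y) _ (*-≉0 x≉0 y≉0) (*-inverse-product x≉0 y≉0))

  *-⁻¹-cancelʳ : ∀ x y → y ≉0 → (x * y) * y ⁻¹ ≈ x
  *-⁻¹-cancelʳ x y y≉0 = trans (*-assoc x y _) (trans (*-congˡ (⁻¹-inverseʳ y y≉0)) (*-identityʳ x))

  ⁻¹-*-cancelʳ : ∀ x y → y ≉0 → (x * y ⁻¹) * y ≈ x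
  ⁻¹-*-cancelʳ x y y≉0 = trans (*-assoc x _ y) (trans (*-congˡ (⁻¹-inverseˡ y y≉0)) (*-identityʳ x))

  ∏-≉0 : ∀ n f → (∀ k → k < n → f k ≉0) → prodℕ n f ≉0
  ∏-≉0 zero f _ = 1≉0
  ∏-≉0 (suc n) f f≉0 = *-≉0 (∏-≉0 n f (λ k k<n → f≉0 k (ℕ.m<n⇒m<1+n k<n))) (f≉0 n ℕ.≤-refl)

  ∏ᶠ-≉0 : ∀ {n} (f : Fin n → Carrier) → (∀ i → f i ≉0) → prodFin f ≉0
  ∏ᶠ-≉0 {zero} f _ = 1≉0
  ∏ᶠ-≉0 {suc n} f f≉0 = *-≉0 (f≉0 Fin.zero) (∏ᶠ-≉0 (f ∘ Fin.suc) (f≉0 ∘ Fin.suc))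

  ∏ᶠ-≉0⁻¹ : ∀ {n} (f : Fin n → Carrier) → prodFin f ≉0 → ∀ i → f i ≉0
  ∏ᶠ-≉0⁻¹ {suc n} f ∏≉0 Fin.zero = ≉0-*ˡ _ _ ∏≉0
  ∏ᶠ-≉0⁻¹ {suc n} f ∏≉0 (Fin.suc i) = ∏ᶠ-≉0⁻¹ (f ∘ Fin.suc) (≉0-*ʳ _ _ ∏≉0) i

  ι-homo-+ : ∀ m n → ι (m ℕ.+ n) ≈ ι m + ι n
  ι-homo-+ zero n = sym (+-identityˡ (ι n))
  ι-homo-+ (suc m) n = trans (+-congˡ (ι-homo-+ m n)) (sym (+-assoc 1# (ι m) (ι n)))

  pow-homo-+ : ∀ x m n → pow x (m ℕ.+ n) ≈ pow x m * pow x n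
  pow-homo-+ x zero n = sym (*-identityˡ _)
  pow-homo-+ x (suc m) n = trans (*-congˡ (pow-homo-+ x m n)) (sym (*-assoc _ _ _))

  pow-distrib-* : ∀ x y n → pow (x * y) n ≈ pow x n * pow y n
  pow-distrib-* x y zero = sym (*-identityˡ 1#)
  pow-distrib-* x y (suc n) = trans (*-congˡ (pow-distrib-* x y n)) (*-interchange _ _ _ _)

  pow-assoc : ∀ x m n → pow (pow x m) n ≈ pow x (m ℕ.* n)
  pow-assoc x m zero = reflexive (≡.cong (pow x) (≡.sym (ℕ.*-zeroʳ m)))
  pow-assoc x m (suc n) = begin
    pow x m * pow (pow x m) n   ≈⟨ *-congˡ (pow-assoc x m n) ⟩
    pow x m * pow x (m ℕ.* n)   ≈⟨ pow-homo-+ x m (m ℕ.* n) ⟨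
    pow x (m ℕ.+ m ℕ.* n)       ≡⟨ ≡.cong (pow x) (ℕ.*-suc m n) ⟨
    pow x (m ℕ.* suc n)         ∎

  pow-≉0 : ∀ {x} n → x ≉0 → pow x n ≉0
  pow-≉0 zero _ = 1≉0
  pow-≉0 (suc n) x≉0 = *-≉0 x≉0 (pow-≉0 n x≉0)

  pow-⁻¹ : ∀ x n → x ≉0 → pow (x ⁻¹) n ≈ pow x n ⁻¹
  pow-⁻¹ x zero _ = ⁻¹-unique 1# 1# 1≉0 (*-identityˡ 1#)
  pow-⁻¹ x (suc n) x≉0 = begin
    x ⁻¹ * pow (x ⁻¹) n   ≈⟨ *-congˡ (pow-⁻¹ x n x≉0) ⟩
    x ⁻¹ * pow x n ⁻¹     ≈⟨ ⁻¹-distrib-* x (pow x n) x≉0 (pow-≉0 n x≉0) ⟨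
    (x * pow x n) ⁻¹      ∎

  ∏ᶠ-const : ∀ {n} x → prodFin {n} (λ _ → x) ≈ pow x n
  ∏ᶠ-const {zero} x = refl
  ∏ᶠ-const {suc n} x = *-congˡ (∏ᶠ-const {n} x)

  ∏ᶠ-pow : ∀ {n} (f : Fin n → Carrier) m → prodFin (λ i → pow (f i) m) ≈ pow (prodFin f) m
  ∏ᶠ-pow {n} f zero = trans (∏ᶠ-const {n} 1#) (pow-1 n)
    where
    pow-1 : ∀ n → pow 1# n ≈ 1#
    pow-1 zero = refl
    pow-1 (suc n) = trans (*-identityˡ _) (pow-1 n)
  ∏ᶠ-pow f (suc m) = trans (∏.⨁ᶠ-distrib f _) (*-congˡ (∏ᶠ-pow f m))

  telescope : ∀ (A B c : ℕ → Carrier) → (∀ k → c (suc k) * B (suc k) ≈ c k * A k) →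
    ∀ d k → c (k ℕ.+ d) * prodℕ d (λ j → B (suc (k ℕ.+ j))) ≈ c k * prodℕ d (λ j → A (k ℕ.+ j))
  telescope A B c step zero k = *-congʳ (reflexive (≡.cong c (ℕ.+-identityʳ k)))
  telescope A B c step (suc d) k = begin
    c (k ℕ.+ suc d) * (∏B * B (suc (k ℕ.+ d)))    ≡⟨ ≡.cong (λ i → c i * (∏B * B (suc (k ℕ.+ d)))) (ℕ.+-suc k d) ⟩
    c (suc (k ℕ.+ d)) * (∏B * B (suc (k ℕ.+ d)))  ≈⟨ *-solve 3 (λ x y z → (x ⊗ (y ⊗ z)) ⊜ ((x ⊗ z) ⊗ y)) refl _ ∏B _ ⟩
    (c (suc (k ℕ.+ d)) * B (suc (k ℕ.+ d))) * ∏B  ≈⟨ *-congʳ (step (k ℕ.+ d)) ⟩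
    (c (k ℕ.+ d) * A (k ℕ.+ d)) * ∏B              ≈⟨ *-solve 3 (λ x y z → ((x ⊗ y) ⊗ z) ⊜ ((x ⊗ z) ⊗ y)) refl _ _ ∏B ⟩
    (c (k ℕ.+ d) * ∏B) * A (k ℕ.+ d)              ≈⟨ *-congʳ (telescope A B c step d k) ⟩
    (c k * prodℕ d (λ j → A (k ℕ.+ j))) * A (k ℕ.+ d) ≈⟨ *-assoc _ _ _ ⟩
    c k * prodℕ (suc d) (λ j → A (k ℕ.+ j))       ∎
    where ∏B = prodℕ d (λ j → B (suc (k ℕ.+ j)))

module Determinant {a ℓ} (F : Field a ℓ) where
  open FieldProperties F

  Matrix : ℕ → Set a
  Matrix N = Fin N → Fin N → Carrier

  sign : ∀ {n} → Fin n → Carrier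
  sign j = pow (- 1#) (toℕ j)

  minor : ∀ {N} → Matrix (suc N) → Fin (suc N) → Matrix N
  minor A j x y = A (Fin.suc x) (punchIn j y)

  expansionTerm : ∀ {N} → Matrix (suc N) → Fin (suc N) → Carrier
  expansionTerm {N} A j = sign j * (A Fin.zero j * det N (minor A j))

  SameRow : ∀ {N} → Matrix N → Matrix N → Fin N → Set ℓ
  SameRow A B z = ∀ y → A z y ≈ B z y

  det-cong : ∀ N {A B : Matrix N} → (∀ x → SameRow A B x) → det N A ≈ det N B
  det-cong zero _ = refl
  det-cong (suc N) {A} {B} A≈B = ∑.⨁ᶠ-cong {f = expansionTerm A} {g = expansionTerm B} (λ j →
    *-congˡ (*-cong (A≈B Fin.zero j) (det-cong N (λ x y → A≈B (Fin.suc x) (punchIn j y)))))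

  det-scaleRows : ∀ N (d : Fin N → Carrier) (A : Matrix N) → det N (λ x y → d x * A x y) ≈ prodFin d * det N A
  det-scaleRows zero d A = sym (*-identityˡ 1#)
  det-scaleRows (suc N) d A = begin
    det (suc N) (λ x y → d x * A x y)                     ≈⟨ ∑.⨁ᶠ-cong {f = expansionTerm (λ x y → d x * A x y)} (λ j → *-congˡ (*-congˡ (det-scaleRows N (d ∘ Fin.suc) (minor A j)))) ⟩
    sumFin (λ j → sign j * ((d₀ * A Fin.zero j) * (D * det N (minor A j))))  ≈⟨ ∑.⨁ᶠ-cong {g = λ j → (d₀ * D) * expansionTerm A j} (λ j → rearrange (sign j) (A Fin.zero j) (det N (minor A j))) ⟩
    sumFin (λ j → (d₀ * D) * expansionTerm A j)            ≈⟨ ∑ᶠ-*ˡ (d₀ * D) (expansionTerm A) ⟩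
    (d₀ * D) * det (suc N) A                              ∎
    where
    d₀ D : Carrier
    d₀ = d Fin.zero
    D = prodFin (d ∘ Fin.suc)
    rearrange : ∀ s x m → s * ((d₀ * x) * (D * m)) ≈ (d₀ * D) * (s * (x * m))
    rearrange s x m = *-solve 5 (λ d₀ D s x m → (s ⊗ ((d₀ ⊗ x) ⊗ (D ⊗ m))) ⊜ ((d₀ ⊗ D) ⊗ (s ⊗ (x ⊗ m)))) refl d₀ D s x m

  det-linearRow : ∀ N {A B C : Matrix N} x α β →
    (∀ z → z ≢ x → SameRow C A z) → (∀ z → z ≢ x → SameRow C B z) →
    (∀ y → C x y ≈ α * A x y + β * B x y) →
    det N C ≈ α * det N A + β * det N B
  det-linearRow (suc N) {A} {B} {C} x α β C≈A C≈B Cₓ = begin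
    sumFin (expansionTerm C)                                              ≈⟨ ∑.⨁ᶠ-cong {f = expansionTerm C} (termwise x C≈A C≈B Cₓ) ⟩
    sumFin (λ j → α * expansionTerm A j + β * expansionTerm B j)          ≈⟨ ∑.⨁ᶠ-distrib (λ j → α * expansionTerm A j) (λ j → β * expansionTerm B j) ⟩
    sumFin (λ j → α * expansionTerm A j) + sumFin (λ j → β * expansionTerm B j)
                                                                          ≈⟨ +-cong (∑ᶠ-*ˡ α (expansionTerm A)) (∑ᶠ-*ˡ β (expansionTerm B)) ⟩
    α * det (suc N) A + β * det (suc N) B                                 ∎
    where
    shuffle : ∀ c s u w → s * ((c * u) * w) ≈ c * (s * (u * w))
    shuffle = *-solve 4 (λ c s u w → (s ⊗ ((c ⊗ u) ⊗ w)) ⊜ (c ⊗ (s ⊗ (u ⊗ w)))) refl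
    shuffle′ : ∀ c s x u → s * (x * (c * u)) ≈ c * (s * (x * u))
    shuffle′ = *-solve 4 (λ c s x u → (s ⊗ (x ⊗ (c ⊗ u))) ⊜ (c ⊗ (s ⊗ (x ⊗ u)))) refl
    termwise : ∀ x → (∀ z → z ≢ x → SameRow C A z) → (∀ z → z ≢ x → SameRow C B z) →
      (∀ y → C x y ≈ α * A x y + β * B x y) →
      ∀ j → expansionTerm C j ≈ α * expansionTerm A j + β * expansionTerm B j
    termwise Fin.zero C≈A C≈B C₀ j = begin
      sign j * (C Fin.zero j * det N (minor C j))                         ≈⟨ *-congˡ (*-congʳ (C₀ j)) ⟩
      sign j * ((α * A Fin.zero j + β * B Fin.zero j) * det N (minor C j))
        ≈⟨ trans (*-congˡ (distribʳ _ _ _)) (trans (distribˡ _ _ _) (+-cong (shuffle α _ _ _) (shuffle β _ _ _))) ⟩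
      α * (sign j * (A Fin.zero j * det N (minor C j))) + β * (sign j * (B Fin.zero j * det N (minor C j)))
        ≈⟨ +-cong (*-congˡ (*-congˡ (*-congˡ (det-cong N (λ u v → C≈A (Fin.suc u) (λ ()) (punchIn j v))))))
                  (*-congˡ (*-congˡ (*-congˡ (det-cong N (λ u v → C≈B (Fin.suc u) (λ ()) (punchIn j v)))))) ⟩
      α * expansionTerm A j + β * expansionTerm B j                       ∎
    termwise (Fin.suc x) C≈A C≈B Cₓ j = begin
      sign j * (C Fin.zero j * det N (minor C j))                         ≈⟨ *-congˡ (*-congˡ minor-linear) ⟩
      sign j * (C Fin.zero j * (α * det N (minor A j) + β * det N (minor B j)))
        ≈⟨ trans (*-congˡ (distribˡ _ _ _)) (trans (distribˡ _ _ _) (+-cong (shuffle′ α _ _ _) (shuffle′ β _ _ _))) ⟩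
      α * (sign j * (C Fin.zero j * det N (minor A j))) + β * (sign j * (C Fin.zero j * det N (minor B j)))
        ≈⟨ +-cong (*-congˡ (*-congˡ (*-congʳ (C≈A Fin.zero (λ ()) j)))) (*-congˡ (*-congˡ (*-congʳ (C≈B Fin.zero (λ ()) j)))) ⟩
      α * expansionTerm A j + β * expansionTerm B j                       ∎
      where
      minor-linear : det N (minor C j) ≈ α * det N (minor A j) + β * det N (minor B j)
      minor-linear = det-linearRow N x α β
        (λ z z≢x y → C≈A (Fin.suc z) (z≢x ∘ Fin.suc-injective) (punchIn j y))
        (λ z z≢x y → C≈B (Fin.suc z) (z≢x ∘ Fin.suc-injective) (punchIn j y))
        (λ y → Cₓ (punchIn j y))

  record Swapped {N} (A B : Matrix N) (x y : Fin N) : Set ℓ where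
    constructor swapped
    field
      at-x      : ∀ c → B x c ≈ A y c
      at-y      : ∀ c → B y c ≈ A x c
      elsewhere : ∀ z → z ≢ x → z ≢ y → SameRow B A z

  sign-suc : ∀ {n} (j : Fin n) → sign (Fin.suc j) ≈ - sign j
  sign-suc j = trans (sym (-‿distribˡ-* 1# _)) (-‿cong (*-identityˡ _))

  sign-punchOut-antisym : ∀ {n} (x y : Fin (suc n)) (x≢y : x ≢ y) (y≢x : y ≢ x) →
    sign y * sign (punchOut y≢x) ≈ - (sign x * sign (punchOut x≢y))
  sign-punchOut-antisym Fin.zero Fin.zero x≢y _ = ⊥-elim (x≢y ≡.refl)
  sign-punchOut-antisym {suc n} Fin.zero (Fin.suc y) _ _ = begin
    sign (Fin.suc y) * 1#   ≈⟨ *-identityʳ _ ⟩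
    sign (Fin.suc y)        ≈⟨ sign-suc y ⟩
    - sign y                ≈⟨ -‿cong (*-identityˡ _) ⟨
    - (1# * sign y)         ∎
  sign-punchOut-antisym {suc n} (Fin.suc x) Fin.zero _ _ = begin
    1# * sign x                ≈⟨ *-identityˡ _ ⟩
    sign x                     ≈⟨ -‿involutive _ ⟨
    - (- sign x)               ≈⟨ -‿cong (sign-suc x) ⟨
    - sign (Fin.suc x)         ≈⟨ -‿cong (*-identityʳ _) ⟨
    - (sign (Fin.suc x) * 1#)  ∎
  sign-punchOut-antisym {suc n} (Fin.suc x) (Fin.suc y) x≢y y≢x = begin
    sign (Fin.suc y) * sign (Fin.suc (punchOut y′≢x′))    ≈⟨ sign-suc² y (punchOut y′≢x′) ⟩
    sign y * sign (punchOut y′≢x′)                        ≈⟨ sign-punchOut-antisym x y x′≢y′ y′≢x′ ⟩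
    - (sign x * sign (punchOut x′≢y′))                    ≈⟨ -‿cong (sign-suc² x (punchOut x′≢y′)) ⟨
    - (sign (Fin.suc x) * sign (Fin.suc (punchOut x′≢y′))) ∎
    where
    x′≢y′ : x ≢ y
    x′≢y′ = x≢y ∘ ≡.cong Fin.suc
    y′≢x′ : y ≢ x
    y′≢x′ = y≢x ∘ ≡.cong Fin.suc
    sign-suc² : ∀ {m n} (i : Fin m) (j : Fin n) → sign (Fin.suc i) * sign (Fin.suc j) ≈ sign i * sign j
    sign-suc² i j = begin
      sign (Fin.suc i) * sign (Fin.suc j)   ≈⟨ *-cong (sign-suc i) (sign-suc j) ⟩
      - sign i * - sign j                   ≈⟨ -‿distribˡ-* _ _ ⟨
      - (sign i * - sign j)                 ≈⟨ -‿cong (-‿distribʳ-* _ _) ⟨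
      - (- (sign i * sign j))               ≈⟨ -‿involutive _ ⟩
      sign i * sign j                       ∎

  punchIn-punchOut-swap : ∀ {n} (x y : Fin (suc (suc n))) (x≢y : x ≢ y) (y≢x : y ≢ x) (z : Fin n) →
    punchIn x (punchIn (punchOut x≢y) z) ≡ punchIn y (punchIn (punchOut y≢x) z)
  punchIn-punchOut-swap Fin.zero Fin.zero x≢y _ _ = ⊥-elim (x≢y ≡.refl)
  punchIn-punchOut-swap Fin.zero (Fin.suc y) _ _ _ = ≡.refl
  punchIn-punchOut-swap (Fin.suc x) Fin.zero _ _ _ = ≡.refl
  punchIn-punchOut-swap (Fin.suc x) (Fin.suc y) _ _ Fin.zero = ≡.refl
  punchIn-punchOut-swap {suc n} (Fin.suc x) (Fin.suc y) x≢y y≢x (Fin.suc z) =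
    ≡.cong Fin.suc (punchIn-punchOut-swap x y (x≢y ∘ ≡.cong Fin.suc) (y≢x ∘ ≡.cong Fin.suc) z)

  -- Expansion along the first two rows as a double sum over all column pairs (x, y); the diagonal
  -- pairs contribute 0, so that the sum can be re-indexed by swapping x and y.
  module TwoRowExpansion {N} (A : Matrix (suc (suc N))) where
    minor₂ : Fin (suc (suc N)) → Fin (suc N) → Matrix N
    minor₂ x k u v = A (Fin.suc (Fin.suc u)) (punchIn x (punchIn k v))

    pairTerm : ∀ x y → Dec (x ≡ y) → Carrier
    pairTerm x y (yes _) = 0#
    pairTerm x y (no x≢y) =
      (sign x * sign (punchOut x≢y)) * ((A Fin.zero x * A (Fin.suc Fin.zero) y) * det N (minor₂ x (punchOut x≢y)))

    term : Fin (suc (suc N)) → Fin (suc (suc N)) → Carrier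
    term x y = pairTerm x y (x Fin.≟ y)

    pairTerm-diagonal : ∀ x (d : Dec (x ≡ x)) → pairTerm x x d ≈ 0#
    pairTerm-diagonal x (yes _) = refl
    pairTerm-diagonal x (no x≢x) = ⊥-elim (x≢x ≡.refl)

    pairTerm-punchIn : ∀ x k (d : Dec (x ≡ punchIn x k)) → pairTerm x (punchIn x k) d ≈
      (sign x * sign k) * ((A Fin.zero x * A (Fin.suc Fin.zero) (punchIn x k)) * det N (minor₂ x k))
    pairTerm-punchIn x k (yes x≡x′) = ⊥-elim (Fin.punchInᵢ≢i x k (≡.sym x≡x′))
    pairTerm-punchIn x k (no x≢x′) = reflexive (≡.cong
      (λ k′ → (sign x * sign k′) * ((A Fin.zero x * A (Fin.suc Fin.zero) (punchIn x k)) * det N (minor₂ x k′)))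
      (≡.trans (Fin.punchOut-cong x ≡.refl) (Fin.punchOut-punchIn x)))

    expand : det (suc (suc N)) A ≈ sumFin (λ x → sumFin (term x))
    expand = ∑.⨁ᶠ-cong {f = expansionTerm A} λ x → begin
      sign x * (A Fin.zero x * sumFin (inner x))             ≈⟨ *-congˡ (∑ᶠ-*ˡ _ (inner x)) ⟨
      sign x * sumFin (λ k → A Fin.zero x * inner x k)       ≈⟨ ∑ᶠ-*ˡ _ (λ k → A Fin.zero x * inner x k) ⟨
      sumFin (λ k → sign x * (A Fin.zero x * inner x k))     ≈⟨ ∑.⨁ᶠ-cong {g = term x ∘ punchIn x} (λ k →
                                                                   trans (shuffle (sign x) (A Fin.zero x) (sign k) _ _)
                                                                         (sym (pairTerm-punchIn x k (x Fin.≟ punchIn x k)))) ⟩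
      sumFin (term x ∘ punchIn x)                             ≈⟨ +-identityˡ _ ⟨
      0# + sumFin (term x ∘ punchIn x)                        ≈⟨ +-congʳ (pairTerm-diagonal x (x Fin.≟ x)) ⟨
      term x x + sumFin (term x ∘ punchIn x)                  ≈⟨ ∑.⨁ᶠ-punchIn (term x) x ⟨
      sumFin (term x)                                         ∎
      where
      inner : Fin (suc (suc N)) → Fin (suc N) → Carrier
      inner x k = sign k * (A (Fin.suc Fin.zero) (punchIn x k) * det N (minor₂ x k))
      shuffle : ∀ s a t b m → s * (a * (t * (b * m))) ≈ (s * t) * ((a * b) * m)
      shuffle = *-solve 5 (λ s a t b m → (s ⊗ (a ⊗ (t ⊗ (b ⊗ m)))) ⊜ ((s ⊗ t) ⊗ ((a ⊗ b) ⊗ m))) refl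

  det-swap01 : ∀ N (A B : Matrix (suc (suc N))) → Swapped A B Fin.zero (Fin.suc Fin.zero) →
    det (suc (suc N)) B ≈ - det (suc (suc N)) A
  det-swap01 N A B (swapped B₀ B₁ Bᵣ) = begin
    det (suc (suc N)) B                          ≈⟨ EB.expand ⟩
    sumFin (λ x → sumFin (EB.term x))            ≈⟨ ∑.⨁ᶠ-comm EB.term ⟩
    sumFin (λ y → sumFin (λ x → EB.term x y))    ≈⟨ ∑.⨁ᶠ-cong {f = λ y → sumFin (λ x → EB.term x y)} (λ y →
                                                      ∑.⨁ᶠ-cong {g = λ x → - EA.term y x} (λ x → transposed y x (x Fin.≟ y) (y Fin.≟ x))) ⟩
    sumFin (λ y → sumFin (λ x → - EA.term y x))  ≈⟨ ∑.⨁ᶠ-cong {g = λ y → - sumFin (EA.term y)} (λ y → ∑ᶠ-neg (EA.term y)) ⟩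
    sumFin (λ y → - sumFin (EA.term y))          ≈⟨ ∑ᶠ-neg (λ y → sumFin (EA.term y)) ⟩
    - sumFin (λ y → sumFin (EA.term y))          ≈⟨ -‿cong EA.expand ⟨
    - det (suc (suc N)) A                        ∎
    where
    module EA = TwoRowExpansion A
    module EB = TwoRowExpansion B
    transposed : ∀ y x (d : Dec (x ≡ y)) (d′ : Dec (y ≡ x)) → EB.pairTerm x y d ≈ - EA.pairTerm y x d′
    transposed y x (yes _) (yes _) = sym -0#≈0#
    transposed y x (yes x≡y) (no y≢x) = ⊥-elim (y≢x (≡.sym x≡y))
    transposed y x (no x≢y) (yes y≡x) = ⊥-elim (x≢y (≡.sym y≡x))
    transposed y x (no x≢y) (no y≢x) = begin
      (sign x * sign (punchOut x≢y)) * ((B Fin.zero x * B (Fin.suc Fin.zero) y) * det N (EB.minor₂ x (punchOut x≢y)))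
        ≈⟨ *-congˡ (*-cong (*-cong (B₀ x) (B₁ y)) (det-cong N (λ u v →
             trans (Bᵣ (Fin.suc (Fin.suc u)) (λ ()) (λ ()) _)
                   (reflexive (≡.cong (A (Fin.suc (Fin.suc u))) (punchIn-punchOut-swap x y x≢y y≢x v)))))) ⟩
      (sign x * sign (punchOut x≢y)) * ((A (Fin.suc Fin.zero) x * A Fin.zero y) * det N (EA.minor₂ y (punchOut y≢x)))
        ≈⟨ *-cong (sign-punchOut-antisym y x y≢x x≢y) (*-congʳ (*-comm _ _)) ⟩
      (- (sign y * sign (punchOut y≢x))) * ((A Fin.zero y * A (Fin.suc Fin.zero) x) * det N (EA.minor₂ y (punchOut y≢x)))
        ≈⟨ -‿distribˡ-* _ _ ⟨
      - EA.pairTerm y x (no y≢x)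
        ∎

  SwapProperty : ℕ → Set (a ⊔ ℓ)
  SwapProperty N = ∀ (A B : Matrix N) x y → x ≢ y → Swapped A B x y → det N B ≈ - det N A

  det-swap-suc : ∀ N → SwapProperty N → ∀ (A B : Matrix (suc N)) x y → x ≢ y →
    Swapped A B (Fin.suc x) (Fin.suc y) → det (suc N) B ≈ - det (suc N) A
  det-swap-suc N swap A B x y x≢y (swapped Bₓ Bᵧ Bᵣ) = begin
    sumFin (expansionTerm B)           ≈⟨ ∑.⨁ᶠ-cong {f = expansionTerm B} {g = λ j → - expansionTerm A j} (λ j → begin
      sign j * (B Fin.zero j * det N (minor B j))      ≈⟨ *-congˡ (*-cong (Bᵣ Fin.zero (λ ()) (λ ()) j) (minor-swapped j)) ⟩
      sign j * (A Fin.zero j * - det N (minor A j))    ≈⟨ *-congˡ (-‿distribʳ-* _ _) ⟨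
      sign j * - (A Fin.zero j * det N (minor A j))    ≈⟨ -‿distribʳ-* _ _ ⟨
      - expansionTerm A j                              ∎) ⟩
    sumFin (λ j → - expansionTerm A j) ≈⟨ ∑ᶠ-neg (expansionTerm A) ⟩
    - det (suc N) A                    ∎
    where
    minor-swapped : ∀ j → det N (minor B j) ≈ - det N (minor A j)
    minor-swapped j = swap (minor A j) (minor B j) x y x≢y (swapped
      (λ c → Bₓ (punchIn j c)) (λ c → Bᵧ (punchIn j c))
      (λ z z≢x z≢y c → Bᵣ (Fin.suc z) (z≢x ∘ Fin.suc-injective) (z≢y ∘ Fin.suc-injective) (punchIn j c)))

  swapRows : ∀ {N} → Matrix N → Fin N → Fin N → Matrix N
  swapRows A i j z with z Fin.≟ i | z Fin.≟ j
  ... | yes _ | _     = A j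
  ... | no _  | yes _ = A i
  ... | no _  | no _  = A z

  swapRows-swapped : ∀ {N} (A : Matrix N) {i j} → i ≢ j → Swapped A (swapRows A i j) i j
  swapRows-swapped A {i} {j} i≢j = swapped at-i at-j elsewhere
    where
    at-i : ∀ c → swapRows A i j i c ≈ A j c
    at-i c with i Fin.≟ i | i Fin.≟ j
    ... | yes _   | _ = refl
    ... | no i≢i  | _ = ⊥-elim (i≢i ≡.refl)
    at-j : ∀ c → swapRows A i j j c ≈ A i c
    at-j c with j Fin.≟ i | j Fin.≟ j
    ... | yes j≡i | _       = ⊥-elim (i≢j (≡.sym j≡i))
    ... | no _    | yes _   = refl
    ... | no _    | no j≢j  = ⊥-elim (j≢j ≡.refl)
    elsewhere : ∀ z → z ≢ i → z ≢ j → SameRow (swapRows A i j) A z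
    elsewhere z z≢i z≢j c with z Fin.≟ i | z Fin.≟ j
    ... | yes z≡i | _       = ⊥-elim (z≢i z≡i)
    ... | no _    | yes z≡j = ⊥-elim (z≢j z≡j)
    ... | no _    | no _    = refl

  -- the transposition (0 y) is the conjugate of (0 1) by (1 y)
  det-swap-zero : ∀ N → SwapProperty N → ∀ (A B : Matrix (suc N)) y →
    Swapped A B Fin.zero (Fin.suc y) → det (suc N) B ≈ - det (suc N) A
  det-swap-zero (suc N) swap A B Fin.zero swp = det-swap01 N A B swp
  det-swap-zero (suc N) swap A B (Fin.suc y) (swapped B₀ Bᵧ Bᵣ) = begin
    det (suc (suc N)) B         ≈⟨ det-swap-suc (suc N) swap D B Fin.zero (Fin.suc y) (λ ()) D-to-B ⟩
    - det (suc (suc N)) D       ≈⟨ -‿cong (det-swap01 N C D (swapRows-swapped C (λ ()))) ⟩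
    - (- det (suc (suc N)) C)   ≈⟨ -‿involutive _ ⟩
    det (suc (suc N)) C         ≈⟨ det-swap-suc (suc N) swap A C Fin.zero (Fin.suc y) (λ ()) (swapRows-swapped A (λ ())) ⟩
    - det (suc (suc N)) A       ∎
    where
    one Y : Fin (suc (suc N))
    one = Fin.suc Fin.zero
    Y = Fin.suc (Fin.suc y)
    C D : Matrix (suc (suc N))
    C = swapRows A one Y
    D = swapRows C Fin.zero one
    module C = Swapped (swapRows-swapped A {one} {Y} (λ ()))
    module D = Swapped (swapRows-swapped C {Fin.zero} {one} (λ ()))
    D-to-B : Swapped D B one Y
    D-to-B = swapped
      (λ c → trans (Bᵣ one (λ ()) (λ ()) c) (sym (trans (D.elsewhere Y (λ ()) (λ ()) c) (C.at-y c))))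
      (λ c → trans (Bᵧ c) (sym (trans (D.at-y c) (C.elsewhere Fin.zero (λ ()) (λ ()) c))))
      B-to-D
      where
      B-to-D : ∀ z → z ≢ one → z ≢ Y → SameRow B D z
      B-to-D Fin.zero _ _ c = trans (B₀ c) (sym (trans (D.at-x c) (C.at-x c)))
      B-to-D (Fin.suc Fin.zero) z≢1 _ c = ⊥-elim (z≢1 ≡.refl)
      B-to-D z@(Fin.suc (Fin.suc _)) _ z≢Y c =
        trans (Bᵣ z (λ ()) z≢Y c) (sym (trans (D.elsewhere z (λ ()) (λ ()) c) (C.elsewhere z (λ ()) z≢Y c)))

  det-swap : ∀ N → SwapProperty N
  det-swap (suc N) A B Fin.zero Fin.zero x≢y _ = ⊥-elim (x≢y ≡.refl)
  det-swap (suc N) A B Fin.zero (Fin.suc y) _ swp = det-swap-zero N (det-swap N) A B y swp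
  det-swap (suc N) A B (Fin.suc x) Fin.zero _ (swapped Bₓ Bᵧ Bᵣ) =
    det-swap-zero N (det-swap N) A B x (swapped Bᵧ Bₓ (λ z z≢y z≢x → Bᵣ z z≢x z≢y))
  det-swap (suc N) A B (Fin.suc x) (Fin.suc y) x≢y swp =
    det-swap-suc N (det-swap N) A B x y (x≢y ∘ ≡.cong Fin.suc) swp

  -- swapping the two equal rows gives det A ≈ - det A
  det-equalRows : (1# + 1#) ≉0 → ∀ N (A : Matrix N) {x y} → x ≢ y → (∀ c → A x c ≈ A y c) → det N A ≈ 0#
  det-equalRows 2≉0 N A {x} {y} x≢y Aₓ≈Aᵧ = begin
    det N A                            ≈⟨ *-identityˡ _ ⟨
    1# * det N A                       ≈⟨ *-congʳ (⁻¹-inverseˡ _ 2≉0) ⟨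
    (2⁻¹ * (1# + 1#)) * det N A        ≈⟨ *-assoc _ _ _ ⟩
    2⁻¹ * ((1# + 1#) * det N A)        ≈⟨ *-congˡ (trans (distribʳ _ _ _) (+-cong (*-identityˡ _) (*-identityˡ _))) ⟩
    2⁻¹ * (det N A + det N A)          ≈⟨ *-congˡ (+-congˡ self-swap) ⟩
    2⁻¹ * (det N A - det N A)          ≈⟨ *-congˡ (-‿inverseʳ _) ⟩
    2⁻¹ * 0#                           ≈⟨ zeroʳ _ ⟩
    0#                                 ∎
    where
    2⁻¹ : Carrier
    2⁻¹ = (1# + 1#) ⁻¹
    self-swap : det N A ≈ - det N A
    self-swap = det-swap N A A x y x≢y (swapped Aₓ≈Aᵧ (sym ∘ Aₓ≈Aᵧ) (λ _ _ _ _ → refl))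

module TriangularReduction {a ℓ} (F : Field a ℓ) where
  open FieldProperties F
  open Determinant F

  det-scaleRow : ∀ N {A C : Matrix N} x α → (∀ z → z ≢ x → SameRow C A z) →
    (∀ y → C x y ≈ α * A x y) → det N C ≈ α * det N A
  det-scaleRow N {A} {C} x α C≈A Cₓ = begin
    det N C                        ≈⟨ det-linearRow N x α 0# C≈A C≈A (λ y → trans (Cₓ y) (sym (+-identityʳ-0* _ _))) ⟩
    α * det N A + 0# * det N A     ≈⟨ +-identityʳ-0* _ _ ⟩
    α * det N A                    ∎
    where
    +-identityʳ-0* : ∀ u v → u + 0# * v ≈ u
    +-identityʳ-0* u v = trans (+-congˡ (zeroˡ v)) (+-identityʳ u)

  replaceRow : ∀ {N} → Matrix N → Fin N → (Fin N → Carrier) → Matrix N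
  replaceRow Φ x v z with z Fin.≟ x
  ... | yes _ = v
  ... | no _  = Φ z

  replaceRow-at : ∀ {N} (Φ : Matrix N) x v c → replaceRow Φ x v x c ≈ v c
  replaceRow-at Φ x v c with x Fin.≟ x
  ... | yes _   = refl
  ... | no x≢x  = ⊥-elim (x≢x ≡.refl)

  replaceRow-elsewhere : ∀ {N} (Φ : Matrix N) x v z → z ≢ x → SameRow (replaceRow Φ x v) Φ z
  replaceRow-elsewhere Φ x v z z≢x c with z Fin.≟ x
  ... | yes z≡x = ⊥-elim (z≢x z≡x)
  ... | no _    = refl

  det-replaceRow-cong : ∀ N (Φ : Matrix N) x {v w} → (∀ c → v c ≈ w c) →
    det N (replaceRow Φ x v) ≈ det N (replaceRow Φ x w)
  det-replaceRow-cong N Φ x v≈w = det-cong N λ z c → helper z c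
    where
    helper : ∀ z c → replaceRow Φ x _ z c ≈ replaceRow Φ x _ z c
    helper z c with z Fin.≟ x
    ... | yes _ = v≈w c
    ... | no _  = refl

  det-replaceRow-self : ∀ N (Φ : Matrix N) x {v} → (∀ c → Φ x c ≈ v c) → det N Φ ≈ det N (replaceRow Φ x v)
  det-replaceRow-self N Φ x Φₓ≈v = det-cong N λ z c → helper z c
    where
    helper : ∀ z c → Φ z c ≈ replaceRow Φ x _ z c
    helper z c with z Fin.≟ x
    ... | yes ≡.refl = Φₓ≈v c
    ... | no _       = refl

  det-replaceRow-linear : ∀ N (Φ : Matrix N) x u t (β : ℕ → Carrier) (w : ℕ → Fin N → Carrier) →
    det N (replaceRow Φ x (λ c → u c + sumℕ t (λ e → β e * w e c))) ≈
    det N (replaceRow Φ x u) + sumℕ t (λ e → β e * det N (replaceRow Φ x (w e)))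
  det-replaceRow-linear N Φ x u zero β w =
    trans (det-replaceRow-cong N Φ x (λ c → +-identityʳ (u c))) (sym (+-identityʳ _))
  det-replaceRow-linear N Φ x u (suc t) β w = begin
    det N (replaceRow Φ x (λ c → u c + sumℕ (suc t) (λ e → β e * w e c)))
      ≈⟨ det-linearRow N x 1# (β t) (same-elsewhere _ _) (same-elsewhere _ _) at-x ⟩
    1# * det N (replaceRow Φ x (λ c → u c + sumℕ t (λ e → β e * w e c))) + β t * det N (replaceRow Φ x (w t))
      ≈⟨ +-congʳ (trans (*-identityˡ _) (det-replaceRow-linear N Φ x u t β w)) ⟩
    (det N (replaceRow Φ x u) + sumℕ t (λ e → β e * det N (replaceRow Φ x (w e)))) + β t * det N (replaceRow Φ x (w t))
      ≈⟨ +-assoc _ _ _ ⟩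
    det N (replaceRow Φ x u) + sumℕ (suc t) (λ e → β e * det N (replaceRow Φ x (w e))) ∎
    where
    same-elsewhere : ∀ v v′ z → z ≢ x → SameRow (replaceRow Φ x v) (replaceRow Φ x v′) z
    same-elsewhere v v′ z z≢x c = trans (replaceRow-elsewhere Φ x v z z≢x c) (sym (replaceRow-elsewhere Φ x v′ z z≢x c))
    at-x : ∀ c → replaceRow Φ x (λ c → u c + sumℕ (suc t) (λ e → β e * w e c)) x c ≈
                 1# * replaceRow Φ x (λ c → u c + sumℕ t (λ e → β e * w e c)) x c + β t * replaceRow Φ x (w t) x c
    at-x c = begin
      replaceRow Φ x _ x c                                    ≈⟨ replaceRow-at Φ x _ c ⟩
      u c + (sumℕ t (λ e → β e * w e c) + β t * w t c)        ≈⟨ +-assoc _ _ _ ⟨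
      (u c + sumℕ t (λ e → β e * w e c)) + β t * w t c
        ≈⟨ +-cong (trans (sym (*-identityˡ _)) (*-congˡ (sym (replaceRow-at Φ x _ c)))) (*-congˡ (sym (replaceRow-at Φ x _ c))) ⟩
      1# * replaceRow Φ x _ x c + β t * replaceRow Φ x (w t) x c ∎

  det-replaceRow-dependent : 1# + 1# ≉0 → ∀ N (Φ M : Matrix N) (d : Fin N → Carrier) x y → y ≢ x →
    (∀ c → Φ y c ≈ d y * M y c) → det N (replaceRow Φ x (M y)) ≈ 0#
  det-replaceRow-dependent 2≉0 N Φ M d x y y≢x Φᵧ = begin
    det N Ψ               ≈⟨ det-scaleRow N y (d y) (λ z z≢y c → sym (replaceRow-elsewhere Ψ y (M y) z z≢y c)) Ψᵧ ⟩
    d y * det N Ψ′        ≈⟨ *-congˡ (det-equalRows 2≉0 N Ψ′ y≢x Ψ′ᵧ≈Ψ′ₓ) ⟩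
    d y * 0#              ≈⟨ zeroʳ _ ⟩
    0#                    ∎
    where
    Ψ Ψ′ : Matrix N
    Ψ = replaceRow Φ x (M y)
    Ψ′ = replaceRow Ψ y (M y)
    Ψᵧ : ∀ c → Ψ y c ≈ d y * Ψ′ y c
    Ψᵧ c = trans (replaceRow-elsewhere Φ x _ y y≢x c) (trans (Φᵧ c) (*-congˡ (sym (replaceRow-at Ψ y _ c))))
    Ψ′ᵧ≈Ψ′ₓ : ∀ c → Ψ′ y c ≈ Ψ′ x c
    Ψ′ᵧ≈Ψ′ₓ c = trans (replaceRow-at Ψ y _ c)
      (sym (trans (replaceRow-elsewhere Ψ y _ x (y≢x ∘ ≡.sym) c) (replaceRow-at Φ x _ c)))

  record LowerTriangularRow {N} (M : Matrix N) (d : Fin N → Carrier) (x : Fin N) (v : Fin N → Carrier) : Set (a ⊔ ℓ) where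
    field
      terms         : ℕ
      coefficient   : ℕ → Carrier
      index         : ℕ → Fin N
      index<        : ∀ e → e < terms → toℕ (index e) < toℕ x
      decomposition : ∀ c → v c ≈ d x * M x c + sumℕ terms (λ e → coefficient e * M (index e) c)

  module _ (2≉0 : 1# + 1# ≉0) N (M : Matrix N) (d : Fin N → Carrier) where

    Reduced : Matrix N → Fin N → Set ℓ
    Reduced Φ x = ∀ c → Φ x c ≈ d x * M x c

    det-reduceRow : ∀ (Φ : Matrix N) x (row : LowerTriangularRow M d x (Φ x)) →
      (∀ e → e < LowerTriangularRow.terms row → Reduced Φ (LowerTriangularRow.index row e)) →
      det N Φ ≈ det N (replaceRow Φ x (λ c → d x * M x c))
    det-reduceRow Φ x row index-reduced = begin
      det N Φ
        ≈⟨ det-replaceRow-self N Φ x decomposition ⟩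
      det N (replaceRow Φ x (λ c → d x * M x c + sumℕ terms (λ e → coefficient e * M (index e) c)))
        ≈⟨ det-replaceRow-linear N Φ x _ terms coefficient (M ∘ index) ⟩
      det N Φ′ + sumℕ terms (λ e → coefficient e * det N (replaceRow Φ x (M (index e))))
        ≈⟨ +-congˡ (∑.⨁-identity terms _ (λ e e<t → trans
             (*-congˡ (det-replaceRow-dependent 2≉0 N Φ M d x (index e) (index≢x e e<t) (index-reduced e e<t)))
             (zeroʳ _))) ⟩
      det N Φ′ + 0#
        ≈⟨ +-identityʳ _ ⟩
      det N Φ′ ∎
      where
      open LowerTriangularRow row
      Φ′ : Matrix N
      Φ′ = replaceRow Φ x (λ c → d x * M x c)
      index≢x : ∀ e → e < terms → index e ≢ x
      index≢x e e<t eq = ℕ.<-irrefl (≡.cong toℕ eq) (index< e e<t)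

    -- the last q rows are still to be reduced, from the top down, so that the rows they refer to are already reduced
    det-reduce : ∀ q (Φ : Matrix N) → (∀ x → LowerTriangularRow M d x (Φ x)) →
      (∀ x → toℕ x ℕ.+ q < N → Reduced Φ x) → det N Φ ≈ prodFin d * det N M
    det-reduce zero Φ _ reduced = begin
      det N Φ                            ≈⟨ det-cong N (λ x → reduced x (≡.subst (_< N) (≡.sym (ℕ.+-identityʳ _)) (Fin.toℕ<n x))) ⟩
      det N (λ x y → d x * M x y)        ≈⟨ det-scaleRows N d M ⟩
      prodFin d * det N M                ∎
    det-reduce (suc q) Φ lower reduced with q ℕ.<? N
    ... | no q≮N = det-reduce q Φ lower (λ x x+q<N → ⊥-elim (q≮N (ℕ.≤-<-trans (ℕ.m≤n+m q (toℕ x)) x+q<N)))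
    ... | yes q<N = trans (det-reduceRow Φ x₀ (lower x₀) index-reduced) (det-reduce q Φ′ lower′ reduced′)
      where
      x₀ : Fin N
      x₀ = Fin.fromℕ< (ℕ.∸-monoʳ-< {N} {suc q} {0} (ℕ.s≤s ℕ.z≤n) q<N)
      x₀+q+1≡N : toℕ x₀ ℕ.+ suc q ≡ N
      x₀+q+1≡N = ≡.trans (≡.cong (ℕ._+ suc q) (Fin.toℕ-fromℕ< _)) (ℕ.m∸n+n≡m q<N)
      open LowerTriangularRow (lower x₀)
      index-reduced : ∀ e → e < terms → Reduced Φ (index e)
      index-reduced e e<t = reduced (index e)
        (≡.subst (toℕ (index e) ℕ.+ suc q <_) x₀+q+1≡N (ℕ.+-monoˡ-< (suc q) (index< e e<t)))
      Φ′ : Matrix N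
      Φ′ = replaceRow Φ x₀ (λ c → d x₀ * M x₀ c)
      lower′ : ∀ x → LowerTriangularRow M d x (Φ′ x)
      lower′ x with x Fin.≟ x₀
      ... | yes ≡.refl = record
        { terms = 0 ; coefficient = λ _ → 0# ; index = λ _ → x ; index< = λ _ ()
        ; decomposition = λ c → sym (+-identityʳ _) }
      ... | no _ = lower x
      reduced′ : ∀ x → toℕ x ℕ.+ q < N → Reduced Φ′ x
      reduced′ x x+q<N with x Fin.≟ x₀
      ... | yes ≡.refl = λ _ → refl
      ... | no x≢x₀ = reduced x (ℕ.≤∧≢⇒< (≡.subst (_≤ N) (≡.sym (ℕ.+-suc (toℕ x) q)) x+q<N) x+q+1≢N)
        where
        x+q+1≢N : toℕ x ℕ.+ suc q ≢ N
        x+q+1≢N eq = x≢x₀ (Fin.toℕ-injective (ℕ.+-cancelʳ-≡ (suc q) _ _ (≡.trans eq (≡.sym x₀+q+1≡N))))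

    det-lowerTriangular : (Φ : Matrix N) → (∀ x → LowerTriangularRow M d x (Φ x)) → det N Φ ≈ prodFin d * det N M
    det-lowerTriangular Φ lower = det-reduce N Φ lower (λ x x+N<N → ⊥-elim (ℕ.m+n≮n (toℕ x) N x+N<N))

module Polynomials {a ℓ} (F : Field a ℓ) where
  open FieldProperties F

  functional-∷ : ∀ f x p → functional f (x ∷ p) ≈ x * f 0 + functional (f ∘ suc) p
  functional-∷ f x p = ∑.⨁-head (length p) (λ k → coeff (x ∷ p) k * f k)

  functional-cong : ∀ {f g} p → (∀ k → f k ≈ g k) → functional f p ≈ functional g p
  functional-cong p f≈g = ∑.⨁-congᵖ (length p) (λ k → *-congˡ (f≈g k))

  functional-+ : ∀ f g p → functional (λ k → f k + g k) p ≈ functional f p + functional g p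
  functional-+ f g p = trans (∑.⨁-congᵖ (length p) (λ k → distribˡ (coeff p k) (f k) (g k)))
    (∑.⨁-distrib (length p) (λ k → coeff p k * f k) (λ k → coeff p k * g k))

  functional-*ˡ : ∀ c f p → functional (λ k → c * f k) p ≈ c * functional f p
  functional-*ˡ c f p = trans (∑.⨁-congᵖ (length p) (λ k → x*[c*y]≈c*[x*y] (coeff p k) (f k))) (∑-*ˡ (length p) c _)
    where
    x*[c*y]≈c*[x*y] : ∀ x y → x * (c * y) ≈ c * (x * y)
    x*[c*y]≈c*[x*y] = *-solve 3 (λ c x y → (x ⊗ (c ⊗ y)) ⊜ (c ⊗ (x ⊗ y))) refl c

  functional-zero : ∀ f p → (∀ k → f k ≈ 0#) → functional f p ≈ 0#
  functional-zero f p f≈0 = ∑.⨁-identity (length p) _ (λ k _ → trans (*-congˡ (f≈0 k)) (zeroʳ _))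

  functional-sumℕ : ∀ n (f : ℕ → ℕ → Carrier) p →
    functional (λ k → sumℕ n (λ e → f e k)) p ≈ sumℕ n (λ e → functional (f e) p)
  functional-sumℕ zero f p = functional-zero _ p (λ _ → refl)
  functional-sumℕ (suc n) f p = trans (functional-+ _ _ p) (+-congʳ (functional-sumℕ n f p))

  functional-0∷ : ∀ f p → functional f (0# ∷ p) ≈ functional (f ∘ suc) p
  functional-0∷ f p = trans (functional-∷ f 0# p) (trans (+-congʳ (zeroˡ _)) (+-identityˡ _))

  functional-+P : ∀ f p q → functional f (p +P q) ≈ functional f p + functional f q
  functional-+P f [] q = sym (+-identityˡ _)
  functional-+P f (x ∷ p) [] = sym (+-identityʳ _)
  functional-+P f (x ∷ p) (y ∷ q) = begin
    functional f ((x + y) ∷ (p +P q))                                       ≈⟨ functional-∷ f (x + y) (p +P q) ⟩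
    (x + y) * f 0 + functional (f ∘ suc) (p +P q)                           ≈⟨ +-cong (distribʳ (f 0) x y) (functional-+P (f ∘ suc) p q) ⟩
    (x * f 0 + y * f 0) + (functional (f ∘ suc) p + functional (f ∘ suc) q) ≈⟨ +-interchange _ _ _ _ ⟩
    (x * f 0 + functional (f ∘ suc) p) + (y * f 0 + functional (f ∘ suc) q) ≈⟨ +-cong (functional-∷ f x p) (functional-∷ f y q) ⟨
    functional f (x ∷ p) + functional f (y ∷ q)                             ∎

  functional-scaleP : ∀ f c p → functional f (scaleP c p) ≈ c * functional f p
  functional-scaleP f c [] = sym (zeroʳ c)
  functional-scaleP f c (x ∷ p) = begin
    functional f (scaleP c (x ∷ p))                   ≈⟨ functional-∷ f (c * x) (scaleP c p) ⟩
    (c * x) * f 0 + functional (f ∘ suc) (scaleP c p) ≈⟨ +-cong (*-assoc c x (f 0)) (functional-scaleP (f ∘ suc) c p) ⟩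
    c * (x * f 0) + c * functional (f ∘ suc) p        ≈⟨ distribˡ c _ _ ⟨
    c * (x * f 0 + functional (f ∘ suc) p)            ≈⟨ *-congˡ (functional-∷ f x p) ⟨
    c * functional f (x ∷ p)                          ∎

  functional-shiftP : ∀ f n p → functional f (shiftP n p) ≈ functional (λ k → f (n ℕ.+ k)) p
  functional-shiftP f zero p = refl
  functional-shiftP f (suc n) p = trans (functional-0∷ f (shiftP n p)) (functional-shiftP (f ∘ suc) n p)

  functional-diagOpFrom : ∀ f k₀ g p → functional f (diagOpFrom k₀ g p) ≈ functional (λ k → g (k₀ ℕ.+ k) * f k) p
  functional-diagOpFrom f k₀ g [] = refl
  functional-diagOpFrom f k₀ g (x ∷ p) = begin
    functional f ((g k₀ * x) ∷ diagOpFrom (suc k₀) g p)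
      ≈⟨ functional-∷ f (g k₀ * x) (diagOpFrom (suc k₀) g p) ⟩
    (g k₀ * x) * f 0 + functional (f ∘ suc) (diagOpFrom (suc k₀) g p)
      ≈⟨ +-cong (*-solve 3 (λ g x f → ((g ⊗ x) ⊗ f) ⊜ (x ⊗ (g ⊗ f))) refl (g k₀) x (f 0)) (functional-diagOpFrom (f ∘ suc) (suc k₀) g p) ⟩
    x * (g k₀ * f 0) + functional (λ k → g (suc k₀ ℕ.+ k) * f (suc k)) p
      ≈⟨ +-cong (*-congˡ (*-congʳ (reflexive (≡.cong g (≡.sym (ℕ.+-identityʳ k₀))))))
                (functional-cong p (λ k → *-congʳ (reflexive (≡.cong g (≡.sym (ℕ.+-suc k₀ k)))))) ⟩
    x * (g (k₀ ℕ.+ 0) * f 0) + functional (λ k → g (k₀ ℕ.+ suc k) * f (suc k)) p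
      ≈⟨ functional-∷ (λ k → g (k₀ ℕ.+ k) * f k) x p ⟨
    functional (λ k → g (k₀ ℕ.+ k) * f k) (x ∷ p) ∎

  functional-Bchain : ∀ {r} (ζ : Fin r → Carrier) f b d p →
    functional f (Bchain ζ b d p) ≈ functional (λ k → prodℕ d (λ e → evalProd ζ (ι (k ℕ.+ (b ℕ.+ e)))) * f k) p
  functional-Bchain ζ f b zero p = functional-cong p (λ k → sym (*-identityˡ _))
  functional-Bchain ζ f b (suc d) p = begin
    functional f (Bop ζ b (Bchain ζ (suc b) d p))
      ≈⟨ functional-diagOpFrom f 0 (λ k → B (k ℕ.+ b)) (Bchain ζ (suc b) d p) ⟩
    functional (λ k → B (k ℕ.+ b) * f k) (Bchain ζ (suc b) d p)
      ≈⟨ functional-Bchain ζ _ (suc b) d p ⟩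
    functional (λ k → prodℕ d (λ e → B (k ℕ.+ (suc b ℕ.+ e))) * (B (k ℕ.+ b) * f k)) p
      ≈⟨ functional-cong p (λ k → begin
           prodℕ d (λ e → B (k ℕ.+ (suc b ℕ.+ e))) * (B (k ℕ.+ b) * f k)
             ≈⟨ *-solve 3 (λ x y z → (x ⊗ (y ⊗ z)) ⊜ ((y ⊗ x) ⊗ z)) refl _ _ _ ⟩
           (B (k ℕ.+ b) * prodℕ d (λ e → B (k ℕ.+ (suc b ℕ.+ e)))) * f k
             ≈⟨ *-congʳ (*-cong (reflexive (≡.cong (λ z → B (k ℕ.+ z)) (≡.sym (ℕ.+-identityʳ b))))
                                 (∏.⨁-congᵖ d (λ e → reflexive (≡.cong (λ z → B (k ℕ.+ z)) (≡.sym (ℕ.+-suc b e)))))) ⟩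
           (B (k ℕ.+ (b ℕ.+ 0)) * prodℕ d (λ e → B (k ℕ.+ (b ℕ.+ suc e)))) * f k
             ≈⟨ *-congʳ (∏.⨁-head d (λ e → B (k ℕ.+ (b ℕ.+ e)))) ⟨
           prodℕ (suc d) (λ e → B (k ℕ.+ (b ℕ.+ e))) * f k ∎) ⟩
    functional (λ k → prodℕ (suc d) (λ e → B (k ℕ.+ (b ℕ.+ e))) * f k) p ∎
    where
    B : ℕ → Carrier
    B k = evalProd ζ (ι k)

  functional-*P : ∀ f p q → functional f (p *P q) ≈ functional (λ b → functional (λ a → f (a ℕ.+ b)) p) q
  functional-*P f [] q = sym (functional-zero _ q (λ _ → refl))
  functional-*P f (x ∷ p) q = begin
    functional f (scaleP x q +P (0# ∷ (p *P q)))
      ≈⟨ functional-+P f (scaleP x q) _ ⟩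
    functional f (scaleP x q) + functional f (0# ∷ (p *P q))
      ≈⟨ +-cong (functional-scaleP f x q) (functional-0∷ f (p *P q)) ⟩
    x * functional f q + functional (f ∘ suc) (p *P q)
      ≈⟨ +-cong (sym (functional-*ˡ x f q)) (functional-*P (f ∘ suc) p q) ⟩
    functional (λ b → x * f b) q + functional (λ b → functional (λ a → f (suc a ℕ.+ b)) p) q
      ≈⟨ functional-+ _ _ q ⟨
    functional (λ b → x * f b + functional (λ a → f (suc a ℕ.+ b)) p) q
      ≈⟨ functional-cong q (λ b → functional-∷ (λ a → f (a ℕ.+ b)) x p) ⟨
    functional (λ b → functional (λ a → f (a ℕ.+ b)) (x ∷ p)) q ∎

  functional-vanishing : ∀ f p → (∀ k → coeff p k ≈ 0#) → functional f p ≈ 0#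
  functional-vanishing f [] _ = refl
  functional-vanishing f (x ∷ p) p≈0 = begin
    functional f (x ∷ p)                ≈⟨ functional-∷ f x p ⟩
    x * f 0 + functional (f ∘ suc) p    ≈⟨ +-cong (trans (*-congʳ (p≈0 0)) (zeroˡ _)) (functional-vanishing (f ∘ suc) p (p≈0 ∘ suc)) ⟩
    0# + 0#                             ≈⟨ +-identityˡ 0# ⟩
    0#                                  ∎

  functional-≈P : ∀ f p q → p ≈P q → functional f p ≈ functional f q
  functional-≈P f [] q p≈q = sym (functional-vanishing f q (sym ∘ p≈q))
  functional-≈P f (x ∷ p) [] p≈q = functional-vanishing f (x ∷ p) p≈q
  functional-≈P f (x ∷ p) (y ∷ q) p≈q = begin
    functional f (x ∷ p)                ≈⟨ functional-∷ f x p ⟩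
    x * f 0 + functional (f ∘ suc) p    ≈⟨ +-cong (*-congʳ (p≈q 0)) (functional-≈P (f ∘ suc) p q (p≈q ∘ suc)) ⟩
    y * f 0 + functional (f ∘ suc) q    ≈⟨ functional-∷ f y q ⟨
    functional f (y ∷ q)                ∎

  eval : Poly → Carrier → Carrier
  eval p x = functional (pow x) p

  eval-*P : ∀ p q x → eval (p *P q) x ≈ eval p x * eval q x
  eval-*P p q x = begin
    functional (pow x) (p *P q)                                   ≈⟨ functional-*P (pow x) p q ⟩
    functional (λ b → functional (λ a → pow x (a ℕ.+ b)) p) q     ≈⟨ functional-cong q (λ b → begin
      functional (λ a → pow x (a ℕ.+ b)) p                            ≈⟨ functional-cong p (λ a → trans (pow-homo-+ x a b) (*-comm _ _)) ⟩
      functional (λ a → pow x b * pow x a) p                          ≈⟨ functional-*ˡ (pow x b) (pow x) p ⟩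
      pow x b * eval p x                                              ≈⟨ *-comm _ _ ⟩
      eval p x * pow x b                                              ∎) ⟩
    functional (λ b → eval p x * pow x b) q                       ≈⟨ functional-*ˡ (eval p x) (pow x) q ⟩
    eval p x * eval q x                                           ∎

  eval-oneP : ∀ x → eval oneP x ≈ 1#
  eval-oneP x = trans (+-identityˡ _) (*-identityˡ 1#)

  eval-linP : ∀ b x → eval (linP b) x ≈ x + b
  eval-linP b x = begin
    (0# + b * 1#) + 1# * (x * 1#)   ≈⟨ +-cong (trans (+-identityˡ _) (*-identityʳ b)) (trans (*-identityˡ _) (*-identityʳ x)) ⟩
    b + x                           ≈⟨ +-comm b x ⟩
    x + b                           ∎

  eval-prodℕP : ∀ n f x → eval (prodℕP n f) x ≈ prodℕ n (λ k → eval (f k) x)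
  eval-prodℕP zero f x = eval-oneP x
  eval-prodℕP (suc n) f x = trans (eval-*P (prodℕP n f) (f n) x) (*-congʳ (eval-prodℕP n f x))

  eval-prodFinP : ∀ {n} (f : Fin n → Poly) x → eval (prodFinP f) x ≈ prodFin (λ i → eval (f i) x)
  eval-prodFinP {zero} f x = eval-oneP x
  eval-prodFinP {suc n} f x = trans (eval-*P (f Fin.zero) _ x) (*-congˡ (eval-prodFinP (f ∘ Fin.suc) x))

  eval-sumFinP : ∀ {n} (f : Fin n → Poly) x → eval (sumFinP f) x ≈ sumFin (λ i → eval (f i) x)
  eval-sumFinP {zero} f x = refl
  eval-sumFinP {suc n} f x = trans (functional-+P (pow x) (f Fin.zero) _) (+-congˡ (eval-sumFinP (f ∘ Fin.suc) x))

  -- Degree< d Q: the d-th finite difference of Q vanishes, i.e. Q is a polynomial function of degree < d.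

  Δ : (ℕ → Carrier) → ℕ → Carrier
  Δ Q k = Q (suc k) - Q k

  Degree< : ℕ → (ℕ → Carrier) → Set ℓ
  Degree< zero Q = ∀ k → Q k ≈ 0#
  Degree< (suc d) Q = Degree< d (Δ Q)

  Degree<-cong : ∀ d {Q R} → (∀ k → Q k ≈ R k) → Degree< d Q → Degree< d R
  Degree<-cong zero Q≈R Q≈0 k = trans (sym (Q≈R k)) (Q≈0 k)
  Degree<-cong (suc d) Q≈R = Degree<-cong d (λ k → +-cong (Q≈R (suc k)) (-‿cong (Q≈R k)))

  Δ-zero : ∀ {Q} → (∀ k → Q k ≈ 0#) → ∀ k → Δ Q k ≈ 0#
  Δ-zero Q≈0 k = trans (+-cong (Q≈0 (suc k)) (-‿cong (Q≈0 k))) (trans (+-identityˡ _) -0#≈0#)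

  Degree<-zero : ∀ d {Q} → (∀ k → Q k ≈ 0#) → Degree< d Q
  Degree<-zero zero Q≈0 = Q≈0
  Degree<-zero (suc d) Q≈0 = Degree<-zero d (Δ-zero Q≈0)

  Degree<-suc : ∀ d {Q} → Degree< d Q → Degree< (suc d) Q
  Degree<-suc zero Q≈0 = Δ-zero Q≈0
  Degree<-suc (suc d) = Degree<-suc d

  Degree<-mono : ∀ {d d′} Q → d ≤ d′ → Degree< d Q → Degree< d′ Q
  Degree<-mono {d′ = d′} Q d≤d′ deg with ℕ.≤⇒≤′ d≤d′
  ... | ℕ.≤′-refl = deg
  ... | ℕ.≤′-step {n = d″} d≤′d″ = Degree<-suc d″ {Q} (Degree<-mono Q (ℕ.≤′⇒≤ d≤′d″) deg)

  Degree<-+ : ∀ d {Q R} → Degree< d Q → Degree< d R → Degree< d (λ k → Q k + R k)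
  Degree<-+ zero Q≈0 R≈0 k = trans (+-cong (Q≈0 k) (R≈0 k)) (+-identityˡ 0#)
  Degree<-+ (suc d) {Q} {R} degQ degR = Degree<-cong d Δ-+ (Degree<-+ d degQ degR)
    where
    Δ-+ : ∀ k → Δ Q k + Δ R k ≈ Δ (λ k → Q k + R k) k
    Δ-+ k = begin
      (Q (suc k) - Q k) + (R (suc k) - R k)           ≈⟨ +-interchange _ _ _ _ ⟩
      (Q (suc k) + R (suc k)) + (- Q k + - R k)       ≈⟨ +-congˡ (-‿anti-homo-+ _ _) ⟨
      (Q (suc k) + R (suc k)) + - (R k + Q k)         ≈⟨ +-congˡ (-‿cong (+-comm _ _)) ⟩
      (Q (suc k) + R (suc k)) - (Q k + R k)           ∎
      where open import Algebra.Properties.Ring ring using (-‿anti-homo-+)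

  Degree<-*ˡ : ∀ d c {Q} → Degree< d Q → Degree< d (λ k → c * Q k)
  Degree<-*ˡ zero c Q≈0 k = trans (*-congˡ (Q≈0 k)) (zeroʳ c)
  Degree<-*ˡ (suc d) c {Q} deg = Degree<-cong d Δ-*ˡ (Degree<-*ˡ d c deg)
    where
    Δ-*ˡ : ∀ k → c * Δ Q k ≈ c * Q (suc k) - c * Q k
    Δ-*ˡ k = trans (distribˡ c _ _) (+-congˡ (sym (-‿distribʳ-* c _)))

  Degree<-shift : ∀ d b {Q} → Degree< d Q → Degree< d (λ k → Q (b ℕ.+ k))
  Degree<-shift d zero deg = deg
  Degree<-shift d (suc b) deg = Degree<-shift d b (shift₁ d deg)
    where
    shift₁ : ∀ d {Q} → Degree< d Q → Degree< d (Q ∘ suc)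
    shift₁ zero Q≈0 = Q≈0 ∘ suc
    shift₁ (suc d) = shift₁ d

  Degree<-shiftʳ : ∀ d b {Q} → Degree< d Q → Degree< d (λ k → Q (k ℕ.+ b))
  Degree<-shiftʳ d b {Q} deg = Degree<-cong d (λ k → reflexive (≡.cong Q (ℕ.+-comm b k))) (Degree<-shift d b deg)

  Degree<-*-linear : ∀ d b {Q} → Degree< d Q → Degree< (suc d) (λ k → Q k * (ι k + b))
  Degree<-*-linear zero b Q≈0 = Degree<-zero 1 (λ k → trans (*-congʳ (Q≈0 k)) (zeroˡ _))
  Degree<-*-linear (suc d) b {Q} deg = Degree<-cong (suc d) Δ-product
    (Degree<-+ (suc d) (Degree<-*-linear d b deg) (Degree<-shift (suc d) 1 deg))
    where
    Δ-product : ∀ k → Δ Q k * (ι k + b) + Q (suc k) ≈ Q (suc k) * (ι (suc k) + b) - Q k * (ι k + b)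
    Δ-product k = begin
      (Q (suc k) - Q k) * L + Q (suc k)                 ≈⟨ +-congʳ ([y-z]x≈yx-zx L _ _) ⟩
      (Q (suc k) * L - Q k * L) + Q (suc k)             ≈⟨ trans (+-comm _ _) (sym (+-assoc _ _ _)) ⟩
      (Q (suc k) + Q (suc k) * L) - Q k * L             ≈⟨ +-congʳ (+-congʳ (*-identityʳ _)) ⟨
      (Q (suc k) * 1# + Q (suc k) * L) - Q k * L        ≈⟨ +-congʳ (distribˡ _ _ _) ⟨
      Q (suc k) * (1# + L) - Q k * L                    ≈⟨ +-congʳ (*-congˡ (+-assoc 1# (ι k) b)) ⟨
      Q (suc k) * (ι (suc k) + b) - Q k * L             ∎
      where
      L : Carrier
      L = ι k + b
      open import Algebra.Properties.Ring ring using ([y-z]x≈yx-zx)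

  Degree<-∏-linear : ∀ q (b : ℕ → Carrier) → Degree< (suc q) (λ k → prodℕ q (λ w → ι k + b w))
  Degree<-∏-linear zero b = λ k → -‿inverseʳ 1#
  Degree<-∏-linear (suc q) b = Degree<-*-linear (suc q) (b q) (Degree<-∏-linear q b)

  -- Moment form of the divisibility of p by (t - α)^N.

  RootOfOrder≥ : Carrier → ℕ → Poly → Set (a ⊔ ℓ)
  RootOfOrder≥ α N p = ∀ Q → Degree< N Q → functional (λ k → pow α k * Q k) p ≈ 0#

  module _ (α : Carrier) where

    rootOfOrder≥-zero : ∀ p → RootOfOrder≥ α 0 p
    rootOfOrder≥-zero p Q Q≈0 = functional-zero _ p (λ k → trans (*-congˡ (Q≈0 k)) (zeroʳ _))

    -- Σ_k ((t - α) q)_k α^k Q(k) = Σ_k q_k α^{k+1} ΔQ(k)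
    rootOfOrder≥-linear : ∀ N q → RootOfOrder≥ α N q → RootOfOrder≥ α (suc N) (linP (- α) *P q)
    rootOfOrder≥-linear N q root Q deg = begin
      functional (λ k → pow α k * Q k) (linP (- α) *P q)
        ≈⟨ functional-*P _ (linP (- α)) q ⟩
      functional (λ b → functional (λ a → pow α (a ℕ.+ b) * Q (a ℕ.+ b)) (linP (- α))) q
        ≈⟨ functional-cong q moment ⟩
      functional (λ k → pow α k * (α * Δ Q k)) q
        ≈⟨ root _ (Degree<-*ˡ N α deg) ⟩
      0# ∎
      where
      moment : ∀ k → functional (λ a → pow α (a ℕ.+ k) * Q (a ℕ.+ k)) (linP (- α)) ≈ pow α k * (α * Δ Q k)
      moment k = begin
        (0# + - α * (pow α k * Q k)) + 1# * ((α * pow α k) * Q (suc k))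
          ≈⟨ +-cong (trans (+-identityˡ _) (sym (-‿distribˡ-* _ _))) (*-identityˡ _) ⟩
        - (α * (pow α k * Q k)) + (α * pow α k) * Q (suc k)
          ≈⟨ +-cong (-‿cong (shuffle (Q k))) (trans (*-assoc _ _ _) (shuffle (Q (suc k)))) ⟩
        - (pow α k * (α * Q k)) + pow α k * (α * Q (suc k))
          ≈⟨ +-comm _ _ ⟩
        pow α k * (α * Q (suc k)) - pow α k * (α * Q k)
          ≈⟨ x[y-z]≈xy-xz _ _ _ ⟨
        pow α k * (α * Q (suc k) - α * Q k)
          ≈⟨ *-congˡ (x[y-z]≈xy-xz _ _ _) ⟨
        pow α k * (α * Δ Q k) ∎
        where
        open import Algebra.Properties.Ring ring using (x[y-z]≈xy-xz)
        shuffle : ∀ x → α * (pow α k * x) ≈ pow α k * (α * x)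
        shuffle x = *-solve 3 (λ a p x → (a ⊗ (p ⊗ x)) ⊜ (p ⊗ (a ⊗ x))) refl α (pow α k) x

    rootOfOrder≥-shiftP : ∀ N p n → RootOfOrder≥ α N p → RootOfOrder≥ α N (shiftP n p)
    rootOfOrder≥-shiftP N p n root Q deg = begin
      functional (λ k → pow α k * Q k) (shiftP n p)                 ≈⟨ functional-shiftP _ n p ⟩
      functional (λ k → pow α (n ℕ.+ k) * Q (n ℕ.+ k)) p            ≈⟨ functional-cong p (λ k → trans (*-congʳ (pow-homo-+ α n k)) (shuffle k)) ⟩
      functional (λ k → pow α k * (pow α n * Q (n ℕ.+ k))) p        ≈⟨ root _ (Degree<-*ˡ N (pow α n) (Degree<-shift N n deg)) ⟩
      0#                                                            ∎
      where
      shuffle : ∀ k → (pow α n * pow α k) * Q (n ℕ.+ k) ≈ pow α k * (pow α n * Q (n ℕ.+ k))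
      shuffle k = *-solve 3 (λ x y z → ((x ⊗ y) ⊗ z) ⊜ (y ⊗ (x ⊗ z))) refl _ _ _

    rootOfOrder≥-*Pʳ : ∀ N p q → RootOfOrder≥ α N q → RootOfOrder≥ α N (p *P q)
    rootOfOrder≥-*Pʳ N [] q root Q deg = refl
    rootOfOrder≥-*Pʳ N (x ∷ p) q root Q deg = begin
      functional f (scaleP x q +P (0# ∷ (p *P q)))              ≈⟨ functional-+P f (scaleP x q) _ ⟩
      functional f (scaleP x q) + functional f (0# ∷ (p *P q))  ≈⟨ +-cong (functional-scaleP f x q) (functional-0∷ f (p *P q)) ⟩
      x * functional f q + functional (f ∘ suc) (p *P q)        ≈⟨ +-cong (trans (*-congˡ (root Q deg)) (zeroʳ x)) (trans
                                                                     (functional-cong (p *P q) (λ k → *-solve 3 (λ a p q → ((a ⊗ p) ⊗ q) ⊜ (p ⊗ (a ⊗ q))) refl α (pow α k) (Q (suc k))))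
                                                                     (rootOfOrder≥-*Pʳ N p q root _ (Degree<-*ˡ N α (Degree<-shift N 1 deg)))) ⟩
      0# + 0#                                                   ≈⟨ +-identityˡ 0# ⟩
      0#                                                        ∎
      where
      f : ℕ → Carrier
      f k = pow α k * Q k

    rootOfOrder≥-*Pˡ : ∀ N p q → RootOfOrder≥ α N p → RootOfOrder≥ α N (p *P q)
    rootOfOrder≥-*Pˡ N p q root Q deg = begin
      functional (λ k → pow α k * Q k) (p *P q)                                 ≈⟨ functional-*P _ p q ⟩
      functional (λ b → functional (λ a → pow α (a ℕ.+ b) * Q (a ℕ.+ b)) p) q   ≈⟨ functional-zero _ q (λ b → trans
                                                                                     (functional-cong p (λ a → trans (*-congʳ (pow-homo-+ α a b)) (*-assoc _ _ _)))
                                                                                     (root _ (Degree<-*ˡ N (pow α b) (Degree<-shiftʳ N b deg)))) ⟩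
      0#                                                                        ∎

    rootOfOrder≥-powP : ∀ N → RootOfOrder≥ α N (powP (linP (- α)) N)
    rootOfOrder≥-powP zero = rootOfOrder≥-zero oneP
    rootOfOrder≥-powP (suc N) = rootOfOrder≥-linear N (powP (linP (- α)) N) (rootOfOrder≥-powP N)

    rootOfOrder≥-prodFinP : ∀ N {m} (f : Fin m → Poly) i → RootOfOrder≥ α N (f i) → RootOfOrder≥ α N (prodFinP f)
    rootOfOrder≥-prodFinP N f Fin.zero root = rootOfOrder≥-*Pˡ N (f Fin.zero) _ root
    rootOfOrder≥-prodFinP N f (Fin.suc i) root = rootOfOrder≥-*Pʳ N (f Fin.zero) _ (rootOfOrder≥-prodFinP N (f ∘ Fin.suc) i root)

module RowReduction {𝔞 ℓ} (F : Field 𝔞 ℓ) where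
  open FieldProperties F
  open Polynomials F

  functional-Ppoly : ∀ {r m} (ζ : Fin r → Carrier) c n (α : Fin m → Carrier) ℓ′ f →
    functional f (shiftP n (Ppoly ζ c n α ℓ′)) ≈
      pow (ι ((n ∸ 1) !)) r ⁻¹ *
      functional (λ k → prodℕ (n ∸ 1) (λ e → evalProd ζ (ι (k ℕ.+ suc e))) * (c k ⁻¹ * f (n ℕ.+ k))) (Hpoly r n α ℓ′)
  functional-Ppoly {r} ζ c n α ℓ′ f = begin
    functional f (shiftP n (scaleP X⁻¹ (Tc c Y)))                      ≈⟨ functional-shiftP f n _ ⟩
    functional (λ k → f (n ℕ.+ k)) (scaleP X⁻¹ (Tc c Y))               ≈⟨ functional-scaleP _ X⁻¹ (Tc c Y) ⟩
    X⁻¹ * functional (λ k → f (n ℕ.+ k)) (Tc c Y)                      ≈⟨ *-congˡ (functional-diagOpFrom _ 0 (λ k → c k ⁻¹) Y) ⟩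
    X⁻¹ * functional (λ k → c k ⁻¹ * f (n ℕ.+ k)) Y                    ≈⟨ *-congˡ (functional-Bchain ζ _ 1 (n ∸ 1) H) ⟩
    X⁻¹ * functional (λ k → prodℕ (n ∸ 1) (λ e → evalProd ζ (ι (k ℕ.+ suc e))) * (c k ⁻¹ * f (n ℕ.+ k))) H ∎
    where
    X⁻¹ : Carrier
    X⁻¹ = pow (ι ((n ∸ 1) !)) r ⁻¹
    H Y : Poly
    H = Hpoly r n α ℓ′
    Y = Bchain ζ 1 (n ∸ 1) H

  extend : ∀ {d} → (Fin d → Carrier) → ℕ → Carrier
  extend {zero} _ _ = 0#
  extend {suc d} f zero = f Fin.zero
  extend {suc d} f (suc k) = extend (f ∘ Fin.suc) k

  extend-toℕ : ∀ {d} (f : Fin d → Carrier) i → f i ≈ extend f (toℕ i)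
  extend-toℕ {suc d} f Fin.zero = refl
  extend-toℕ {suc d} f (Fin.suc i) = extend-toℕ (f ∘ Fin.suc) i

  module Assuming
    {r : ℕ} (η ζ : Fin r → Carrier)
    (AB≉0 : ∀ k → evalProd η (ι k) * evalProd ζ (ι k) ≉0)
    (c : ℕ → Carrier) (c≉0 : ∀ k → c k ≉0)
    (c-rec : ∀ k → c (suc k) ≈ (c k * evalProd η (ι k)) * evalProd ζ (ι (suc k)) ⁻¹)
    (n : ℕ) (1≤n : 1 ≤ n)
    (γ : ℕ → Carrier) (γ≈ζ : ∀ j → γ (r ∸ toℕ j) ≈ ζ j)
    where
    A B : ℕ → Carrier
    A k = evalProd η (ι k)
    B k = evalProd ζ (ι k)

    factor : ℕ → ℕ → Carrier
    factor K w = ι K + γ w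

    B≉0 : ∀ K → B K ≉0
    B≉0 K = ≉0-*ʳ _ _ (AB≉0 K)

    ζ-factor≉0 : ∀ K v → ι K + ζ v ≉0
    ζ-factor≉0 K = ∏ᶠ-≉0⁻¹ (λ v → ι K + ζ v) (B≉0 K)

    factor≉0 : ∀ K {w} → 1 ≤ w → w ≤ r → factor K w ≉0
    factor≉0 K {w} 1≤w w≤r = ≉0-cong (+-congˡ (sym (trans (reflexive (≡.cong γ w≡r-v)) (γ≈ζ v)))) (ζ-factor≉0 K v)
      where
      r-w<r : r ∸ w < r
      r-w<r = ℕ.∸-monoʳ-< {r} {w} {0} 1≤w w≤r
      v : Fin r
      v = Fin.fromℕ< r-w<r
      w≡r-v : w ≡ r ∸ toℕ v
      w≡r-v = ≡.sym (≡.trans (≡.cong (r ∸_) (Fin.toℕ-fromℕ< r-w<r)) (ℕ.m∸[m∸n]≡n w≤r))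

    ∏-factor≉0 : ∀ q (w : ℕ → ℕ) K → (∀ e → e < q → 1 ≤ w e) → (∀ e → e < q → w e ≤ r) →
      prodℕ q (λ e → factor K (w e)) ≉0
    ∏-factor≉0 q w K 1≤w w≤r = ∏-≉0 q _ (λ e e<q → factor≉0 K (1≤w e e<q) (w≤r e e<q))

    B≈∏factor : ∀ K → B K ≈ prodℕ r (λ w → factor K (suc w))
    B≈∏factor K = begin
      prodFin (λ v → ι K + ζ v)                 ≈⟨ ∏.⨁ᶠ-toℕ _ (λ v → factor K (r ∸ v)) (λ v → +-congˡ (sym (γ≈ζ v))) ⟩
      prodℕ r (λ v → factor K (r ∸ v))          ≈⟨ ∏.⨁-reverse r _ ⟩
      prodℕ r (λ w → factor K (r ∸ (r ∸ suc w))) ≈⟨ ∏.⨁-cong r (λ w w<r → reflexive (≡.cong (factor K) (ℕ.m∸[m∸n]≡n w<r))) ⟩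
      prodℕ r (λ w → factor K (suc w))          ∎

    -- the numerator of c_{n+k} / c_k
    E : ℕ → Carrier
    E k = prodℕ n (λ j → A (k ℕ.+ j))

    ∏B : ℕ → Carrier
    ∏B k = prodℕ (n ∸ 1) (λ e → B (k ℕ.+ suc e))

    n-1+1≡n : suc (n ∸ 1) ≡ n
    n-1+1≡n = ℕ.m+[n∸m]≡n 1≤n

    c-ratio : ∀ k → ∏B k * (c k ⁻¹ * c (n ℕ.+ k)) ≈ E k * B (n ℕ.+ k) ⁻¹
    c-ratio k = begin
      ∏B k * (c k ⁻¹ * c (n ℕ.+ k))                     ≈⟨ *-⁻¹-cancelʳ _ _ (B≉0 (n ℕ.+ k)) ⟨
      (∏B k * (c k ⁻¹ * c (n ℕ.+ k)) * B (n ℕ.+ k)) * B (n ℕ.+ k) ⁻¹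
        ≈⟨ *-congʳ (*-solve 4 (λ p i c b → ((p ⊗ (i ⊗ c)) ⊗ b) ⊜ (i ⊗ (c ⊗ (p ⊗ b)))) refl _ _ _ _) ⟩
      (c k ⁻¹ * (c (n ℕ.+ k) * (∏B k * B (n ℕ.+ k)))) * B (n ℕ.+ k) ⁻¹
        ≈⟨ *-congʳ (*-congˡ shifted-telescope) ⟩
      (c k ⁻¹ * (c k * E k)) * B (n ℕ.+ k) ⁻¹
        ≈⟨ *-congʳ (trans (sym (*-assoc _ _ _)) (trans (*-congʳ (⁻¹-inverseˡ _ (c≉0 k))) (*-identityˡ _))) ⟩
      E k * B (n ℕ.+ k) ⁻¹                              ∎
      where
      step : ∀ k → c (suc k) * B (suc k) ≈ c k * A k
      step k = trans (*-congʳ (c-rec k)) (⁻¹-*-cancelʳ _ _ (B≉0 (suc k)))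
      shifted-telescope : c (n ℕ.+ k) * (∏B k * B (n ℕ.+ k)) ≈ c k * E k
      shifted-telescope = begin
        c (n ℕ.+ k) * (∏B k * B (n ℕ.+ k))
          ≈⟨ *-cong (reflexive (≡.cong c (ℕ.+-comm n k)))
                    (*-cong (∏.⨁-congᵖ (n ∸ 1) (λ e → reflexive (≡.cong B (ℕ.+-suc k e))))
                            (reflexive (≡.cong B (≡.trans (ℕ.+-comm n k) (≡.trans (≡.cong (k ℕ.+_) (≡.sym n-1+1≡n)) (ℕ.+-suc k (n ∸ 1))))))) ⟩
        c (k ℕ.+ n) * prodℕ (suc (n ∸ 1)) (λ j → B (suc (k ℕ.+ j)))
          ≡⟨ ≡.cong (λ d → c (k ℕ.+ n) * prodℕ d (λ j → B (suc (k ℕ.+ j)))) n-1+1≡n ⟩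
        c (k ℕ.+ n) * prodℕ n (λ j → B (suc (k ℕ.+ j)))
          ≈⟨ telescope A B c step n k ⟩
        c k * E k                                        ∎

    E≈eval : ∀ k → E k ≈ eval (prodℕP n (λ j → shiftedPoly η (suc j))) (ι (n ℕ.+ k))
    E≈eval k = begin
      prodℕ n (λ j → A (k ℕ.+ j))                                 ≈⟨ ∏.⨁-reverse n _ ⟩
      prodℕ n (λ j → A (k ℕ.+ (n ∸ suc j)))                       ≈⟨ ∏.⨁-cong n factor≈ ⟩
      prodℕ n (λ j → eval (shiftedPoly η (suc j)) (ι (n ℕ.+ k)))  ≈⟨ eval-prodℕP n _ _ ⟨
      eval (prodℕP n (λ j → shiftedPoly η (suc j))) (ι (n ℕ.+ k)) ∎
      where
      factor≈ : ∀ j → j < n → A (k ℕ.+ (n ∸ suc j)) ≈ eval (shiftedPoly η (suc j)) (ι (n ℕ.+ k))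
      factor≈ j j<n = sym (trans (eval-prodFinP (λ i → linP (η i - ι (suc j))) (ι (n ℕ.+ k))) (∏.⨁ᶠ-cong (λ i → begin
        eval (linP (η i - ι (suc j))) (ι (n ℕ.+ k))     ≈⟨ eval-linP _ _ ⟩
        ι (n ℕ.+ k) + (η i - ι (suc j))                 ≡⟨ ≡.cong (λ z → ι z + (η i - ι (suc j))) n+k≡x+j+1 ⟩
        ι (x ℕ.+ suc j) + (η i - ι (suc j))             ≈⟨ +-congʳ (ι-homo-+ x (suc j)) ⟩
        (ι x + ι (suc j)) + (η i - ι (suc j))           ≈⟨ cancel (ι x) (ι (suc j)) (η i) ⟩
        ι x + η i                                       ∎)))
        where
        x : ℕ
        x = k ℕ.+ (n ∸ suc j)
        n+k≡x+j+1 : n ℕ.+ k ≡ x ℕ.+ suc j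
        n+k≡x+j+1 = ≡.trans (ℕ.+-comm n k)
          (≡.trans (≡.cong (k ℕ.+_) (≡.sym (ℕ.m∸n+n≡m j<n))) (≡.sym (ℕ.+-assoc k (n ∸ suc j) (suc j))))
        cancel : ∀ u v w → (u + v) + (w - v) ≈ u + w
        cancel u v w = begin
          (u + v) + (w - v)   ≈⟨ +-interchange _ _ _ _ ⟩
          (u + w) + (v - v)   ≈⟨ +-congˡ (-‿inverseʳ v) ⟩
          (u + w) + 0#        ≈⟨ +-identityʳ _ ⟩
          u + w               ∎

    module Row {m} (α : Fin m → Carrier) (i : Fin m) (jF : Fin r)
               (aⱼ : Fin (suc (r ℕ.* n)) → Carrier) (expansion : IsExpansion η γ n jF aⱼ) where

      j s rn : ℕ
      j = toℕ jF
      s = r ∸ suc j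
      rn = r ℕ.* n

      j<r : j < r
      j<r = Fin.toℕ<n jF

      s+j+1≡r : s ℕ.+ suc j ≡ r
      s+j+1≡r = ℕ.m∸n+n≡m j<r

      j≤rn : j ≤ rn
      j≤rn = ℕ.≤-trans (ℕ.<⇒≤ j<r) (ℕ.m≤m*n r n)
        where instance _ = ℕ.>-nonZero 1≤n

      a : ℕ → Carrier
      a = extend aⱼ

      lowerFactors : ℕ → Carrier
      lowerFactors K = prodℕ s (λ w → factor K (suc w))

      -- (K+γ_{s+1})⋯(K+γ_{s+e}), the basis of the expansion of E
      upperFactors : ℕ → ℕ → Carrier
      upperFactors e K = prodℕ e (λ w → factor K (s ℕ.+ suc w))

      -- (K+γ_r)⋯(K+γ_{r-u}) = (K+ζ₁)⋯(K+ζ_{u+1})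
      ζFactors : ℕ → ℕ → Carrier
      ζFactors u K = prodℕ (suc u) (λ v → factor K (r ∸ v))

      extraFactors : ℕ → ℕ → Carrier
      extraFactors q K = prodℕ q (λ w → factor K (s ℕ.+ suc (suc j ℕ.+ w)))

      lowerFactors≉0 : ∀ K → lowerFactors K ≉0
      lowerFactors≉0 K = ∏-factor≉0 s suc K (λ _ _ → s≤s z≤n) (λ w w<s → ℕ.≤-trans w<s (ℕ.m∸n≤m r (suc j)))

      upperFactors≉0 : ∀ {e} → e ≤ suc j → ∀ K → upperFactors e K ≉0
      upperFactors≉0 {e} e≤j+1 K = ∏-factor≉0 e (λ w → s ℕ.+ suc w) K
        (λ w _ → ℕ.≤-trans (s≤s z≤n) (ℕ.m≤n+m (suc w) s))
        (λ w w<e → ≡.subst (s ℕ.+ suc w ≤_) s+j+1≡r (ℕ.+-monoʳ-≤ s (ℕ.≤-trans w<e e≤j+1)))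

      ζFactors≉0 : ∀ {u} → u ≤ j → ∀ K → ζFactors u K ≉0
      ζFactors≉0 {u} u≤j K = ∏-factor≉0 (suc u) (r ∸_) K
        (λ v v≤u → ℕ.m<n⇒0<n∸m (ℕ.≤-<-trans (ℕ.≤-trans (ℕ.s≤s⁻¹ v≤u) u≤j) j<r))
        (λ v _ → ℕ.m∸n≤m r v)

      B≈lower*upper : ∀ K → B K ≈ lowerFactors K * upperFactors (suc j) K
      B≈lower*upper K = begin
        B K                                          ≈⟨ B≈∏factor K ⟩
        prodℕ r (λ w → factor K (suc w))             ≡⟨ ≡.cong (λ d → prodℕ d (λ w → factor K (suc w))) s+j+1≡r ⟨
        prodℕ (s ℕ.+ suc j) (λ w → factor K (suc w)) ≈⟨ ∏.⨁-split s (suc j) _ ⟩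
        lowerFactors K * prodℕ (suc j) (λ w → factor K (suc (s ℕ.+ w)))
          ≈⟨ *-congˡ (∏.⨁-congᵖ (suc j) (λ w → reflexive (≡.cong (factor K) (≡.sym (ℕ.+-suc s w))))) ⟩
        lowerFactors K * upperFactors (suc j) K      ∎

      upper≈upper*ζFactors : ∀ {e} → e ≤ j → ∀ K → upperFactors (suc j) K ≈ upperFactors e K * ζFactors (j ∸ e) K
      upper≈upper*ζFactors {e} e≤j K = begin
        prodℕ (suc j) f                          ≡⟨ ≡.cong (λ d → prodℕ d f) j+1≡e+u+1 ⟩
        prodℕ (e ℕ.+ suc u) f                    ≈⟨ ∏.⨁-split e (suc u) f ⟩
        upperFactors e K * prodℕ (suc u) (λ w → f (e ℕ.+ w))
          ≈⟨ *-congˡ (∏.⨁-cong (suc u) (λ w w≤u → reflexive (≡.cong (factor K) (≡.sym (index w (ℕ.s≤s⁻¹ w≤u)))))) ⟩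
        upperFactors e K * prodℕ (suc u) (λ w → factor K (r ∸ (u ∸ w)))
          ≈⟨ *-congˡ (∏.⨁-reverse (suc u) (λ v → factor K (r ∸ v))) ⟨
        upperFactors e K * ζFactors u K          ∎
        where
        u : ℕ
        u = j ∸ e
        f : ℕ → Carrier
        f w = factor K (s ℕ.+ suc w)
        e+u≡j : e ℕ.+ u ≡ j
        e+u≡j = ℕ.m+[n∸m]≡n e≤j
        j+1≡e+u+1 : suc j ≡ e ℕ.+ suc u
        j+1≡e+u+1 = ≡.trans (≡.cong suc (≡.sym e+u≡j)) (≡.sym (ℕ.+-suc e u))
        index : ∀ w → w ≤ u → r ∸ (u ∸ w) ≡ s ℕ.+ suc (e ℕ.+ w)
        index w w≤u = ≡.trans (≡.cong (_∸ (u ∸ w)) (≡.sym sum≡r)) (ℕ.m+n∸n≡m _ (u ∸ w))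
          where
          sum≡r : s ℕ.+ suc (e ℕ.+ w) ℕ.+ (u ∸ w) ≡ r
          sum≡r = ≡.trans (ℕ.+-assoc s (suc (e ℕ.+ w)) (u ∸ w))
            (≡.trans (≡.cong (λ z → s ℕ.+ suc z) (ℕ.+-assoc e w (u ∸ w)))
            (≡.trans (≡.cong (λ z → s ℕ.+ suc (e ℕ.+ z)) (ℕ.m+[n∸m]≡n w≤u))
            (≡.trans (≡.cong (λ z → s ℕ.+ suc z) e+u≡j) s+j+1≡r)))

      upper≈upper*extra : ∀ q K → upperFactors (suc j ℕ.+ q) K ≈ upperFactors (suc j) K * extraFactors q K
      upper≈upper*extra q K = ∏.⨁-split (suc j) q _

      E≈expansion : ∀ k → E k ≈ sumℕ (suc rn) (λ e → a e * upperFactors e (n ℕ.+ k))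
      E≈expansion k = begin
        E k                                     ≈⟨ E≈eval k ⟩
        eval (prodℕP n (λ j → shiftedPoly η (suc j))) (ι K)  ≈⟨ functional-≈P (pow (ι K)) (prodℕP n (λ j → shiftedPoly η (suc j))) (sumFinP basisTerm) expansion ⟩
        eval (sumFinP basisTerm) (ι K)          ≈⟨ eval-sumFinP basisTerm (ι K) ⟩
        sumFin (λ e → eval (basisTerm e) (ι K)) ≈⟨ ∑.⨁ᶠ-toℕ _ _ (λ e → begin
          eval (basisTerm e) (ι K)                                     ≈⟨ functional-scaleP (pow (ι K)) (aⱼ e) (basis (toℕ e)) ⟩
          aⱼ e * eval (basis (toℕ e)) (ι K)                             ≈⟨ *-cong (extend-toℕ aⱼ e) (eval-prodℕP (toℕ e) _ (ι K)) ⟩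
          a (toℕ e) * prodℕ (toℕ e) (λ w → eval (linP (γ (s ℕ.+ suc w))) (ι K))
                                                                       ≈⟨ *-congˡ (∏.⨁-congᵖ (toℕ e) (λ w → eval-linP _ _)) ⟩
          a (toℕ e) * upperFactors (toℕ e) K                           ∎) ⟩
        sumℕ (suc rn) (λ e → a e * upperFactors e K) ∎
        where
        K : ℕ
        K = n ℕ.+ k
        basis : ℕ → Poly
        basis e = prodℕP e (λ w → linP (γ (s ℕ.+ suc w)))
        basisTerm : Fin (suc rn) → Poly
        basisTerm e = scaleP (aⱼ e) (basis (toℕ e))

      -- the terms a_e with e ≤ j give entries of M, those with e > j a polynomial in K of degree < rn
      principalPart polynomialPart : ℕ → Carrier
      principalPart K = sumℕ (suc j) (λ e → a e * ζFactors (j ∸ e) K ⁻¹)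
      polynomialPart K = sumℕ (rn ∸ j) (λ q → a (suc j ℕ.+ q) * extraFactors q K)

      expansion/upper : ∀ K → sumℕ (suc rn) (λ e → a e * upperFactors e K) * upperFactors (suc j) K ⁻¹ ≈
                              principalPart K + polynomialPart K
      expansion/upper K = begin
        sumℕ (suc rn) (λ e → a e * upperFactors e K) * U⁻¹         ≈⟨ *-comm _ _ ⟩
        U⁻¹ * sumℕ (suc rn) (λ e → a e * upperFactors e K)         ≈⟨ ∑-*ˡ (suc rn) U⁻¹ _ ⟨
        sumℕ (suc rn) (λ e → U⁻¹ * (a e * upperFactors e K))       ≈⟨ ∑.⨁-congᵖ (suc rn) (λ e → *-solve 3 (λ u x y → (u ⊗ (x ⊗ y)) ⊜ (x ⊗ (y ⊗ u))) refl U⁻¹ _ _) ⟩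
        sumℕ (suc rn) g                                            ≡⟨ ≡.cong (λ d → sumℕ d g) (≡.cong suc (≡.sym (ℕ.m+[n∸m]≡n j≤rn))) ⟩
        sumℕ (suc j ℕ.+ (rn ∸ j)) g                                ≈⟨ ∑.⨁-split (suc j) (rn ∸ j) g ⟩
        sumℕ (suc j) g + sumℕ (rn ∸ j) (λ q → g (suc j ℕ.+ q))     ≈⟨ +-cong (∑.⨁-cong (suc j) (λ e e≤j → *-congˡ (principal e (ℕ.s≤s⁻¹ e≤j))))
                                                                             (∑.⨁-congᵖ (rn ∸ j) (λ q → *-congˡ (polynomial q))) ⟩
        principalPart K + polynomialPart K                         ∎
        where
        U⁻¹ : Carrier
        U⁻¹ = upperFactors (suc j) K ⁻¹
        g : ℕ → Carrier
        g e = a e * (upperFactors e K * U⁻¹)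
        principal : ∀ e → e ≤ j → upperFactors e K * U⁻¹ ≈ ζFactors (j ∸ e) K ⁻¹
        principal e e≤j = begin
          upperFactors e K * U⁻¹                                       ≈⟨ *-congˡ (⁻¹-cong (upperFactors≉0 ℕ.≤-refl K) (upper≈upper*ζFactors e≤j K)) ⟩
          upperFactors e K * (upperFactors e K * ζFactors (j ∸ e) K) ⁻¹ ≈⟨ *-congˡ (⁻¹-distrib-* _ _ Uₑ≉0 (ζFactors≉0 (ℕ.m∸n≤m j e) K)) ⟩
          upperFactors e K * (upperFactors e K ⁻¹ * ζFactors (j ∸ e) K ⁻¹) ≈⟨ *-assoc _ _ _ ⟨
          (upperFactors e K * upperFactors e K ⁻¹) * ζFactors (j ∸ e) K ⁻¹ ≈⟨ *-congʳ (⁻¹-inverseʳ _ Uₑ≉0) ⟩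
          1# * ζFactors (j ∸ e) K ⁻¹                                   ≈⟨ *-identityˡ _ ⟩
          ζFactors (j ∸ e) K ⁻¹                                        ∎
          where
          Uₑ≉0 : upperFactors e K ≉0
          Uₑ≉0 = upperFactors≉0 (ℕ.≤-trans e≤j (ℕ.n≤1+n j)) K
        polynomial : ∀ q → upperFactors (suc j ℕ.+ q) K * U⁻¹ ≈ extraFactors q K
        polynomial q = begin
          upperFactors (suc j ℕ.+ q) K * U⁻¹                    ≈⟨ *-congʳ (trans (upper≈upper*extra q K) (*-comm _ _)) ⟩
          (extraFactors q K * upperFactors (suc j) K) * U⁻¹     ≈⟨ *-⁻¹-cancelʳ _ _ (upperFactors≉0 ℕ.≤-refl K) ⟩
          extraFactors q K                                      ∎

      αᵢ : Carrier
      αᵢ = α i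

      -- the coefficient of h_{ℓ,k} in ψ_{i,s}(t^n P_ℓ)
      weight-identity : ∀ k → ∏B k * (c k ⁻¹ * ((lowerFactors (n ℕ.+ k) * c (n ℕ.+ k)) * pow αᵢ (suc (n ℕ.+ k)))) ≈
                              αᵢ * (pow αᵢ (n ℕ.+ k) * (principalPart (n ℕ.+ k) + polynomialPart (n ℕ.+ k)))
      weight-identity k = begin
        ∏B k * (c k ⁻¹ * ((L * c K) * (αᵢ * αᴷ)))
          ≈⟨ *-solve 6 (λ p i l c a b → (p ⊗ (i ⊗ ((l ⊗ c) ⊗ (a ⊗ b)))) ⊜ ((p ⊗ (i ⊗ c)) ⊗ (l ⊗ (a ⊗ b)))) refl (∏B k) (c k ⁻¹) L (c K) αᵢ αᴷ ⟩
        (∏B k * (c k ⁻¹ * c K)) * (L * (αᵢ * αᴷ))        ≈⟨ *-congʳ (c-ratio k) ⟩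
        (E k * B K ⁻¹) * (L * (αᵢ * αᴷ))                 ≈⟨ *-congʳ (*-congˡ (⁻¹-cong (B≉0 K) (B≈lower*upper K))) ⟩
        (E k * (L * U) ⁻¹) * (L * (αᵢ * αᴷ))             ≈⟨ *-congʳ (*-congˡ (⁻¹-distrib-* L U (lowerFactors≉0 K) (upperFactors≉0 ℕ.≤-refl K))) ⟩
        (E k * (L ⁻¹ * U ⁻¹)) * (L * (αᵢ * αᴷ))
          ≈⟨ *-solve 6 (λ e l⁻ u⁻ l a b → ((e ⊗ (l⁻ ⊗ u⁻)) ⊗ (l ⊗ (a ⊗ b))) ⊜ ((l⁻ ⊗ l) ⊗ (a ⊗ (b ⊗ (e ⊗ u⁻))))) refl (E k) (L ⁻¹) (U ⁻¹) L αᵢ αᴷ ⟩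
        (L ⁻¹ * L) * (αᵢ * (αᴷ * (E k * U ⁻¹)))          ≈⟨ trans (*-congʳ (⁻¹-inverseˡ L (lowerFactors≉0 K))) (*-identityˡ _) ⟩
        αᵢ * (αᴷ * (E k * U ⁻¹))                         ≈⟨ *-congˡ (*-congˡ (trans (*-congʳ (E≈expansion k)) (expansion/upper K))) ⟩
        αᵢ * (αᴷ * (principalPart K + polynomialPart K)) ∎
        where
        K : ℕ
        K = n ℕ.+ k
        L U αᴷ : Carrier
        L = lowerFactors K
        U = upperFactors (suc j) K
        αᴷ = pow αᵢ K

      tⁿH : ℕ → Poly
      tⁿH ℓ′ = shiftP n (Hpoly r n α ℓ′)

      M : ℕ → ℕ → Carrier
      M u ℓ′ = functional (λ K → pow αᵢ K * ζFactors u K ⁻¹) (tⁿH ℓ′)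

      tⁿH-root : ∀ ℓ′ → RootOfOrder≥ αᵢ rn (tⁿH ℓ′)
      tⁿH-root ℓ′ = rootOfOrder≥-shiftP αᵢ rn _ n (rootOfOrder≥-shiftP αᵢ rn _ ℓ′
        (rootOfOrder≥-prodFinP αᵢ rn (λ i′ → powP (linP (- α i′)) rn) i (rootOfOrder≥-powP αᵢ rn)))

      ψ-row : ∀ ℓ′ → ψ γ c αᵢ s (shiftP n (Ppoly ζ c n α ℓ′)) ≈
                     pow (ι ((n ∸ 1) !)) r ⁻¹ * (αᵢ * sumℕ (suc j) (λ e → a e * M (j ∸ e) ℓ′))
      ψ-row ℓ′ = begin
        ψ γ c αᵢ s (shiftP n (Ppoly ζ c n α ℓ′))
          ≈⟨ functional-Ppoly ζ c n α ℓ′ _ ⟩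
        X⁻¹ * functional (λ k → ∏B k * (c k ⁻¹ * ((lowerFactors (n ℕ.+ k) * c (n ℕ.+ k)) * pow αᵢ (suc (n ℕ.+ k))))) H
          ≈⟨ *-congˡ (functional-cong H weight-identity) ⟩
        X⁻¹ * functional (λ k → αᵢ * (pow αᵢ (n ℕ.+ k) * (principalPart (n ℕ.+ k) + polynomialPart (n ℕ.+ k)))) H
          ≈⟨ *-congˡ (functional-*ˡ αᵢ _ H) ⟩
        X⁻¹ * (αᵢ * functional (λ k → pow αᵢ (n ℕ.+ k) * (principalPart (n ℕ.+ k) + polynomialPart (n ℕ.+ k))) H)
          ≈⟨ *-congˡ (*-congˡ (functional-shiftP _ n H)) ⟨
        X⁻¹ * (αᵢ * functional (λ K → pow αᵢ K * (principalPart K + polynomialPart K)) (tⁿH ℓ′))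
          ≈⟨ *-congˡ (*-congˡ (trans (functional-cong (tⁿH ℓ′) (λ K → distribˡ _ _ _)) (functional-+ _ _ (tⁿH ℓ′)))) ⟩
        X⁻¹ * (αᵢ * (functional (λ K → pow αᵢ K * principalPart K) (tⁿH ℓ′) +
                     functional (λ K → pow αᵢ K * polynomialPart K) (tⁿH ℓ′)))
          ≈⟨ *-congˡ (*-congˡ (trans (+-cong principal polynomial) (+-identityʳ _))) ⟩
        X⁻¹ * (αᵢ * sumℕ (suc j) (λ e → a e * M (j ∸ e) ℓ′)) ∎
        where
        X⁻¹ : Carrier
        X⁻¹ = pow (ι ((n ∸ 1) !)) r ⁻¹
        H : Poly
        H = Hpoly r n α ℓ′
        pull : ∀ x y z → x * (y * z) ≈ y * (x * z)
        pull = *-solve 3 (λ x y z → (x ⊗ (y ⊗ z)) ⊜ (y ⊗ (x ⊗ z))) refl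
        principal : functional (λ K → pow αᵢ K * principalPart K) (tⁿH ℓ′) ≈ sumℕ (suc j) (λ e → a e * M (j ∸ e) ℓ′)
        principal = begin
          functional (λ K → pow αᵢ K * principalPart K) (tⁿH ℓ′)
            ≈⟨ functional-cong (tⁿH ℓ′) (λ K → trans (sym (∑-*ˡ (suc j) _ _)) (∑.⨁-congᵖ (suc j) (λ e → pull _ _ _))) ⟩
          functional (λ K → sumℕ (suc j) (λ e → a e * (pow αᵢ K * ζFactors (j ∸ e) K ⁻¹))) (tⁿH ℓ′)
            ≈⟨ functional-sumℕ (suc j) _ (tⁿH ℓ′) ⟩
          sumℕ (suc j) (λ e → functional (λ K → a e * (pow αᵢ K * ζFactors (j ∸ e) K ⁻¹)) (tⁿH ℓ′))
            ≈⟨ ∑.⨁-congᵖ (suc j) (λ e → functional-*ˡ (a e) _ (tⁿH ℓ′)) ⟩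
          sumℕ (suc j) (λ e → a e * M (j ∸ e) ℓ′) ∎
        extra-degree : ∀ q → q < rn ∸ j → Degree< rn (extraFactors q)
        extra-degree q q<rn-j = Degree<-mono (extraFactors q) (ℕ.≤-trans q<rn-j (ℕ.m∸n≤m rn j)) (Degree<-∏-linear q _)
        polynomial : functional (λ K → pow αᵢ K * polynomialPart K) (tⁿH ℓ′) ≈ 0#
        polynomial = begin
          functional (λ K → pow αᵢ K * polynomialPart K) (tⁿH ℓ′)
            ≈⟨ functional-cong (tⁿH ℓ′) (λ K → trans (sym (∑-*ˡ (rn ∸ j) _ _)) (∑.⨁-congᵖ (rn ∸ j) (λ q → pull _ _ _))) ⟩
          functional (λ K → sumℕ (rn ∸ j) (λ q → a (suc j ℕ.+ q) * (pow αᵢ K * extraFactors q K))) (tⁿH ℓ′)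
            ≈⟨ functional-sumℕ (rn ∸ j) _ (tⁿH ℓ′) ⟩
          sumℕ (rn ∸ j) (λ q → functional (λ K → a (suc j ℕ.+ q) * (pow αᵢ K * extraFactors q K)) (tⁿH ℓ′))
            ≈⟨ ∑.⨁-identity (rn ∸ j) _ (λ q q<rn-j → trans (functional-*ˡ _ _ (tⁿH ℓ′))
                 (trans (*-congˡ (tⁿH-root ℓ′ (extraFactors q) (extra-degree q q<rn-j))) (zeroʳ _))) ⟩
          0# ∎

      Mentry≈M : ∀ (uF : Fin r) ℓ′ → Mentry ζ n α i uF ℓ′ ≈ M (toℕ uF) ℓ′
      Mentry≈M uF ℓ′ = functional-cong (tⁿH ℓ′) (λ K → *-congˡ (⁻¹-cong
        (∏ᶠ-≉0 _ (λ v → ζ-factor≉0 K (embed v)))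
        (∏.⨁ᶠ-toℕ _ (λ v → factor K (r ∸ v)) (λ v → +-congˡ (sym (trans
          (reflexive (≡.cong (λ w → γ (r ∸ w)) (≡.sym (Fin.toℕ-inject≤ v (Fin.toℕ<n uF)))))
          (γ≈ζ (embed v))))))))
        where
        embed : Fin (suc (toℕ uF)) → Fin r
        embed v = inject≤ v (Fin.toℕ<n uF)

module ThetaReduction {𝔞 ℓ} (F : Field 𝔞 ℓ) where
  open FieldProperties F
  open Determinant F
  open TriangularReduction F

  module Assuming (charZero : CharZero)
    {r : ℕ} (η ζ : Fin r → Carrier)
    (AB≉0 : ∀ k → evalProd η (ι k) * evalProd ζ (ι k) ≉0)
    (c : ℕ → Carrier) (c≉0 : ∀ k → c k ≉0)
    (c-rec : ∀ k → c (suc k) ≈ (c k * evalProd η (ι k)) * evalProd ζ (ι (suc k)) ⁻¹)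
    (m n : ℕ) (1≤n : 1 ≤ n) (α : Fin m → Carrier)
    (γ : ℕ → Carrier) (γ≈ζ : ∀ j → γ (r ∸ toℕ j) ≈ ζ j)
    (a : Fin r → Fin (suc (r ℕ.* n)) → Carrier) (expansion : ∀ s → IsExpansion η γ n s (a s))
    where
    open RowReduction.Assuming F η ζ AB≉0 c c≉0 c-rec n 1≤n γ γ≈ζ

    2≉0 : 1# + 1# ≉0
    2≉0 = ≉0-cong (+-congˡ (+-identityʳ 1#)) (charZero 1)

    X : Carrier
    X = ι ((n ∸ 1) !)

    X≉0 : X ≉0
    X≉0 = ≉0-cong (reflexive (≡.cong ι (ℕ.suc-pred ((n ∸ 1) !) {{(n ∸ 1) ℕ.!≢0}}))) (charZero ((n ∸ 1) ! ∸ 1))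

    module Rowᵢⱼ (i : Fin m) (jF : Fin r) = Row α i jF (a jF) (expansion jF)

    Θ-matrix M-matrix : Matrix (m ℕ.* r)
    Θ-matrix x ℓ′ = ψ γ c (α (proj₁ (remQuot {m} r x))) (r ∸ suc (toℕ (proj₂ (remQuot {m} r x))))
                      (shiftP n (Ppoly ζ c n α (toℕ ℓ′)))
    M-matrix x ℓ′ = Mentry ζ n α (proj₁ (remQuot {m} r x)) (proj₂ (remQuot {m} r x)) (toℕ ℓ′)

    diagonal : Fin (m ℕ.* r) → Carrier
    diagonal x = (pow X r ⁻¹ * α (proj₁ (remQuot {m} r x))) * a (proj₂ (remQuot {m} r x)) Fin.zero

    Θ-rows : ∀ x → LowerTriangularRow M-matrix diagonal x (Θ-matrix x)
    Θ-rows x = record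
      { terms = j ; coefficient = λ e → (X⁻ʳ * α i) * R.a (suc e) ; index = index ; index< = index<
      ; decomposition = decomposition }
      where
      i : Fin m
      i = proj₁ (remQuot {m} r x)
      jF : Fin r
      jF = proj₂ (remQuot {m} r x)
      module R = Rowᵢⱼ i jF
      open R using (j; j<r; M; Mentry≈M)
      X⁻ʳ : Carrier
      X⁻ʳ = pow X r ⁻¹
      j-e-1<r : ∀ e → j ∸ suc e < r
      j-e-1<r e = ℕ.≤-<-trans (ℕ.m∸n≤m j (suc e)) j<r
      index : ℕ → Fin (m ℕ.* r)
      index e = combine i (Fin.fromℕ< (j-e-1<r e))
      toℕx : toℕ x ≡ r ℕ.* toℕ i ℕ.+ j
      toℕx = ≡.trans (≡.cong toℕ (≡.sym (Fin.combine-remQuot {m} r x))) (Fin.toℕ-combine i jF)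
      index< : ∀ e → e < j → toℕ (index e) < toℕ x
      index< e e<j = ≡.subst₂ _<_
        (≡.sym (≡.trans (Fin.toℕ-combine i _) (≡.cong (r ℕ.* toℕ i ℕ.+_) (Fin.toℕ-fromℕ< (j-e-1<r e)))))
        (≡.sym toℕx)
        (ℕ.+-monoʳ-< (r ℕ.* toℕ i) (ℕ.∸-monoʳ-< {j} {suc e} {0} (s≤s z≤n) e<j))
      M-index : ∀ e ℓ′ → M-matrix (index e) ℓ′ ≈ M (j ∸ suc e) (toℕ ℓ′)
      M-index e ℓ′ = trans
        (reflexive (≡.cong (λ p → Mentry ζ n α (proj₁ p) (proj₂ p) (toℕ ℓ′)) (Fin.remQuot-combine i _)))
        (trans (Mentry≈M _ (toℕ ℓ′)) (reflexive (≡.cong (λ u → M u (toℕ ℓ′)) (Fin.toℕ-fromℕ< (j-e-1<r e)))))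
      decomposition : ∀ ℓ′ → Θ-matrix x ℓ′ ≈ diagonal x * M-matrix x ℓ′ + sumℕ j (λ e → ((X⁻ʳ * α i) * R.a (suc e)) * M-matrix (index e) ℓ′)
      decomposition ℓ′ = begin
        Θ-matrix x ℓ′                                                       ≈⟨ R.ψ-row L ⟩
        X⁻ʳ * (α i * sumℕ (suc j) (λ e → R.a e * M (j ∸ e) L))             ≈⟨ *-assoc _ _ _ ⟨
        (X⁻ʳ * α i) * sumℕ (suc j) (λ e → R.a e * M (j ∸ e) L)             ≈⟨ *-congˡ (∑.⨁-head j _) ⟩
        (X⁻ʳ * α i) * (R.a 0 * M j L + sumℕ j (λ e → R.a (suc e) * M (j ∸ suc e) L))
                                                                            ≈⟨ distribˡ _ _ _ ⟩
        (X⁻ʳ * α i) * (R.a 0 * M j L) + (X⁻ʳ * α i) * sumℕ j (λ e → R.a (suc e) * M (j ∸ suc e) L)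
          ≈⟨ +-cong (trans (sym (*-assoc _ _ _)) (*-congˡ (sym (Mentry≈M jF L))))
                    (trans (sym (∑-*ˡ j _ _)) (∑.⨁-congᵖ j (λ e → trans (sym (*-assoc _ _ _)) (*-congˡ (sym (M-index e ℓ′)))))) ⟩
        diagonal x * M-matrix x ℓ′ + sumℕ j (λ e → ((X⁻ʳ * α i) * R.a (suc e)) * M-matrix (index e) ℓ′) ∎
        where
        L : ℕ
        L = toℕ ℓ′

    ∏diagonal : prodFin diagonal ≈
      (prodFin (λ i → pow (α i) r) * prodFin (λ s → pow (a s Fin.zero) m)) * pow X (r ℕ.* r ℕ.* m) ⁻¹
    ∏diagonal = begin
      prodFin diagonal
        ≈⟨ ∏.⨁ᶠ-combine m diagonal ⟩
      prodFin {m} (λ i → prodFin {r} (λ jF → diagonal (combine i jF)))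
        ≈⟨ ∏.⨁ᶠ-cong (λ i → ∏.⨁ᶠ-cong (λ jF → reflexive (≡.cong (λ p → (X⁻ʳ * α (proj₁ p)) * a (proj₂ p) Fin.zero) (Fin.remQuot-combine i jF)))) ⟩
      prodFin (λ i → prodFin (λ jF → (X⁻ʳ * α i) * a₀ jF))
        ≈⟨ ∏.⨁ᶠ-cong (λ i → trans (∏.⨁ᶠ-distrib (λ _ → X⁻ʳ * α i) a₀) (*-congʳ (∏ᶠ-const {r} (X⁻ʳ * α i)))) ⟩
      prodFin (λ i → pow (X⁻ʳ * α i) r * prodFin a₀)
        ≈⟨ ∏.⨁ᶠ-distrib (λ i → pow (X⁻ʳ * α i) r) (λ _ → prodFin a₀) ⟩
      prodFin (λ i → pow (X⁻ʳ * α i) r) * prodFin {m} (λ _ → prodFin a₀)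
        ≈⟨ *-cong (trans (∏.⨁ᶠ-cong (λ i → pow-distrib-* X⁻ʳ (α i) r)) (∏.⨁ᶠ-distrib (λ _ → pow X⁻ʳ r) (λ i → pow (α i) r)))
                  (trans (∏ᶠ-const {m} (prodFin a₀)) (sym (∏ᶠ-pow a₀ m))) ⟩
      (prodFin {m} (λ _ → pow X⁻ʳ r) * prodFin (λ i → pow (α i) r)) * prodFin (λ s → pow (a₀ s) m)
        ≈⟨ *-solve 3 (λ x y z → ((x ⊗ y) ⊗ z) ⊜ ((y ⊗ z) ⊗ x)) refl _ _ _ ⟩
      (prodFin (λ i → pow (α i) r) * prodFin (λ s → pow (a₀ s) m)) * prodFin {m} (λ _ → pow X⁻ʳ r)
        ≈⟨ *-congˡ X-power ⟩
      (prodFin (λ i → pow (α i) r) * prodFin (λ s → pow (a₀ s) m)) * pow X (r ℕ.* r ℕ.* m) ⁻¹ ∎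
      where
      X⁻ʳ : Carrier
      X⁻ʳ = pow X r ⁻¹
      a₀ : Fin r → Carrier
      a₀ s = a s Fin.zero
      Xʳ≉0 : pow X r ≉0
      Xʳ≉0 = pow-≉0 r X≉0
      X-power : prodFin {m} (λ _ → pow X⁻ʳ r) ≈ pow X (r ℕ.* r ℕ.* m) ⁻¹
      X-power = begin
        prodFin {m} (λ _ → pow X⁻ʳ r)    ≈⟨ ∏ᶠ-const {m} (pow X⁻ʳ r) ⟩
        pow (pow X⁻ʳ r) m                 ≈⟨ pow-assoc X⁻ʳ r m ⟩
        pow X⁻ʳ (r ℕ.* m)                 ≈⟨ pow-⁻¹ (pow X r) (r ℕ.* m) Xʳ≉0 ⟩
        pow (pow X r) (r ℕ.* m) ⁻¹        ≈⟨ ⁻¹-cong (pow-≉0 (r ℕ.* m) Xʳ≉0) (trans (pow-assoc X r (r ℕ.* m)) (reflexive (≡.cong (pow X) (≡.sym (ℕ.*-assoc r r m))))) ⟩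
        pow X (r ℕ.* r ℕ.* m) ⁻¹          ∎

lemma4p3 : ∀ {a ℓ} (F : Field a ℓ) → let open FieldOps F in
    CharZero →
    (r : ℕ) → 1 ≤ r →
    (η ζ : Fin r → Carrier) →
    (∀ (k : ℕ) → ¬ ((evalProd η (ι k) * evalProd ζ (ι k)) ≈ 0#)) →
    (c : ℕ → Carrier) →
    (∀ k → ¬ (c k ≈ 0#)) →
    (∀ k → c (suc k) ≈ ((c k * evalProd η (ι k)) * evalProd ζ (ι (suc k)) ⁻¹)) →
    (m n : ℕ) → 1 ≤ m → 1 ≤ n →
    (α : Fin m → Carrier) →
    (∀ i → ¬ (α i ≈ 0#)) →
    (∀ i j → α i ≈ α j → i ≡ j) →
    (γ : ℕ → Carrier) →
    (∀ (j : Fin r) → γ (r ∸ toℕ j) ≈ ζ j) →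
    (a : Fin r → Fin (suc (r ℕ.* n)) → Carrier) →
    (∀ s → IsExpansion η γ n s (a s)) →
    Θ r ζ c γ n α ≈
      (((prodFin (λ i → pow (α i) r) * prodFin (λ s → pow (a s Fin.zero) m))
        * pow (ι ((n ∸ 1) !)) (r ℕ.* r ℕ.* m) ⁻¹)
        * detM r ζ n α)
lemma4p3 F charZero r _ η ζ AB≉0 c c≉0 c-rec m n _ 1≤n α _ _ γ γ≈ζ a expansion = begin
  Θ r ζ c γ n α                     ≈⟨ det-lowerTriangular 2≉0 (m ℕ.* r) M-matrix diagonal Θ-matrix Θ-rows ⟩
  prodFin diagonal * detM r ζ n α   ≈⟨ *-congʳ ∏diagonal ⟩
  _                                 ∎
  where
  open FieldProperties F
  open TriangularReduction F
  open ThetaReduction.Assuming F charZero η ζ AB≉0 c c≉0 c-rec m n 1≤n α γ γ≈ζ a expansion
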